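{- Let $r$ be a positive integer and let $$g(x)=\frac{1-(r-1)x+x^2+\sqrt{1-2(r-1)x+(r^2-6r+3)x^2-2(r-1)x^3+x^4}}{2(1-x^2)}.$$ Then $g(x)\in\mathbb{Z}[[x]]$, $g(0)=1$, and its central transform (defined in the context) is the generating function of the Narayana polynomials evaluated at $r$: $$\mathbf{C}(g(x))=\sum_{n\ge0}\left(\sum_{k=0}^n N_{n,k}r^k\right)x^n=\frac{1-(r+1)x-\sqrt{1-2(r+1)x+(r-1)^2x^2}}{2rx^2},$$ where $N_{n,k}=\frac{1}{k+1}\binom{n}{k}\binom{n+1}{k}$.
   Context: For a power series $g(x)\in\mathbb{Z}[[x]]$ with $g(0)=1$, let $t_{n,k}=[x^n]\,\frac{1}{1-x}\,\frac{1}{g\left(\frac{x}{1-x}\right)}\left(\frac{x}{1-x}\right)^k$ for $n,k\ge0$, where $[x^n]$ extracts the coefficient of $x^n$. The central transform $\mathbf{C}(g(x))$ is the power series $\sum_{n\ge0}b_nx^n$ with $b_n=t_{2n,n}$. The square root of a power series with constant term $1$ denotes the unique square root with constant term $1$. -}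

module Defs where

open import Data.Nat as ℕ using (ℕ; zero; suc; _∸_)
open import Data.Nat.Combinatorics using (_C_)
open import Data.Integer as ℤ using (ℤ; +_)
open import Data.Rational using (ℚ; _/_; 0ℚ; 1ℚ; ½; _+_; _*_; _-_; -_)
open import Data.List using (List; []; _∷_; _++_)

PS : Set
PS = ℕ → ℚ

ℕ→ℚ : ℕ → ℚ
ℕ→ℚ n = (+ n) / 1

ℤ→ℚ : ℤ → ℚ
ℤ→ℚ z = z / 1

sumBelow : ℕ → (ℕ → ℚ) → ℚ
sumBelow zero    f = 0ℚ
sumBelow (suc n) f = sumBelow n f + f n

sumTo : ℕ → (ℕ → ℚ) → ℚ
sumTo n f = sumBelow (suc n) f

constPS : ℚ → PS
constPS c zero    = c
constPS c (suc n) = 0ℚ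

oneS : PS
oneS = constPS 1ℚ

_⊕_ : PS → PS → PS
(a ⊕ b) n = a n + b n

_⊖_ : PS → PS → PS
(a ⊖ b) n = a n - b n

scalePS : ℚ → PS → PS
scalePS c a n = c * a n

_⊛_ : PS → PS → PS
(a ⊛ b) n = sumTo n (λ i → a i * b (n ∸ i))

powPS : PS → ℕ → PS
powPS h zero    = oneS
powPS h (suc j) = h ⊛ powPS h j

-- composition f(h(x)), meaningful when h(0) = 0:
-- [x^n] f(h) = Σ_{j=0}^{n} f_j [x^n] h^j
compose : PS → PS → PS
compose f h n = sumTo n (λ j → f j * powPS h j n)

nth : List ℚ → ℕ → ℚ
nth []       _       = 0ℚ
nth (x ∷ xs) zero    = x
nth (x ∷ xs) (suc n) = nth xs n

-- course-of-values recursion: the n-th value is  step n prev,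
-- where prev i is the i-th value for i < n.
table : (ℕ → (ℕ → ℚ) → ℚ) → ℕ → List ℚ
table step zero    = []
table step (suc n) = table step n ++ (step n (nth (table step n)) ∷ [])

cov : (ℕ → (ℕ → ℚ) → ℚ) → PS
cov step n = nth (table step (suc n)) n

-- Multiplicative inverse of a series a with a(0) = 1:
-- u_0 = 1, u_n = - Σ_{i=1}^{n} a_i u_{n-i}.
invPS : PS → PS
invPS a = cov step
  where
  step : ℕ → (ℕ → ℚ) → ℚ
  step zero    u = 1ℚ
  step (suc m) u = - sumBelow (suc m) (λ j → a (suc j) * u (m ∸ j))

-- The unique square root with constant term 1 of a series a with a(0) = 1:
-- s_0 = 1, s_n = (a_n - Σ_{i=1}^{n-1} s_i s_{n-i}) / 2  (n ≥ 1),
-- i.e. the unique s with s(0) = 1 and s ⊛ s = a.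
sqrtPS : PS → PS
sqrtPS a = cov step
  where
  step : ℕ → (ℕ → ℚ) → ℚ
  step zero    s = 1ℚ
  step (suc m) s = ½ * (a (suc m) - sumBelow m (λ j → s (suc j) * s (m ∸ j)))

poly4 : ℚ → ℚ → ℚ → ℚ → ℚ → PS
poly4 c0 c1 c2 c3 c4 0 = c0
poly4 c0 c1 c2 c3 c4 1 = c1
poly4 c0 c1 c2 c3 c4 2 = c2
poly4 c0 c1 c2 c3 c4 3 = c3
poly4 c0 c1 c2 c3 c4 4 = c4
poly4 c0 c1 c2 c3 c4 (suc (suc (suc (suc (suc _))))) = 0ℚ

geomPS : PS
geomPS n = 1ℚ

xOver1mx : PS
xOver1mx zero    = 0ℚ
xOver1mx (suc n) = 1ℚ

tArr : PS → ℕ → ℕ → ℚ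
tArr g n k = (geomPS ⊛ (invPS (compose g xOver1mx) ⊛ powPS xOver1mx k)) n

centralTransform : PS → PS
centralTransform g n = tArr g (n ℕ.+ n) n

gSeries : ℕ → PS
gSeries r = scalePS ½ (invPS (poly4 1ℚ 0ℚ (- 1ℚ) 0ℚ 0ℚ) ⊛ (numer ⊕ sqrtPS disc))
  where
  ρ : ℚ
  ρ = ℕ→ℚ r
  numer : PS
  numer = poly4 1ℚ (- (ρ - 1ℚ)) 1ℚ 0ℚ 0ℚ
  two : ℚ
  two = ℕ→ℚ 2
  disc : PS
  disc = poly4 1ℚ (- (two * (ρ - 1ℚ))) (ρ * ρ - ℕ→ℚ 6 * ρ + ℕ→ℚ 3)
               (- (two * (ρ - 1ℚ))) 1ℚ

narayana : ℕ → ℕ → ℚ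
narayana n k = (+ ((n C k) ℕ.* (suc n C k))) / suc k

narayanaPoly : ℕ → ℕ → ℚ
narayanaPoly r n = sumTo n (λ k → narayana n k * ℕ→ℚ (r ℕ.^ k))

closedNumer : ℕ → PS
closedNumer r = poly4 1ℚ (- (ρ + 1ℚ)) 0ℚ 0ℚ 0ℚ ⊖ sqrtPS disc
  where
  ρ : ℚ
  ρ = ℕ→ℚ r
  disc : PS
  disc = poly4 1ℚ (- (ℕ→ℚ 2 * (ρ + 1ℚ))) ((ρ - 1ℚ) * (ρ - 1ℚ)) 0ℚ 0ℚ

module Submission where

-- Write h = 1/g and F = (1 − x²) g = (N + √D)/2, where N = 1 − (r−1)x + x² and
-- D = N² − 4rx².  Then F(0) = 1 and F² − N F + r x² = 0, and the recurrence this
-- gives for the coefficients of F shows that F, hence g, is integral.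
--
-- As 1/(1−x) (x/(1−x))^m has coefficients C(k, m), t_{2n,n} = Σ_i h_i C(2n, n+i).
-- The columns C(2n, n+j) form a Riordan array: their generating functions are A₀ vʲ
-- with v = x (1+v)² and A₀ (1 − 2x(1+v)) = 1, so C(g) = h(v) A₀.  Substituting v
-- into the equation for F shows that y = C(g) solves r x² y² + 1 = (1 − (r+1)x) y.
-- The sums Σ_k C(n,k) C(n,k+j) r^k form another Riordan array, with columns A₀′ wʲ
-- where w = x (1 + (1+r)w + r w²); as N(n,k) = C(n,k)² − C(n,k+1) C(n,k−1), the
-- Narayana series is A₀′ (1 − r w²) = w / x, which solves the same equation.  Its
-- solution is unique, and (1 − (r+1)x − 2r x² y)² = 1 − 2(r+1)x + (r−1)²x² gives
-- the closed form.

open import Defs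
open import Data.Nat as ℕ using (ℕ; zero; suc; _∸_; _≤_; _<_; z≤n; s≤s)
import Data.Nat.Properties as ℕP
open import Data.Rational as Q using (ℚ; _*_; _-_; -_; 0ℚ; 1ℚ; ½)
import Data.Rational.Properties as ℚP
open import Data.Product using (Σ; _×_; _,_; proj₁; proj₂)
open import Data.Sum using (inj₁; inj₂)
open import Relation.Binary.PropositionalEquality

module Casts where
  open import Data.Nat.Coprimality using (1-coprimeTo) renaming (sym to coprime-sym)
  open import Data.Integer as ℤ using (+_; -[1+_])
  import Data.Integer.Properties as ℤP
  open Q using (mkℚ; _+_)

  ℤ→ℚ-mkℚ : ∀ z → ℤ→ℚ z ≡ mkℚ z 0 (coprime-sym (1-coprimeTo ℤ.∣ z ∣))
  ℤ→ℚ-mkℚ (+ n)    = ℚP.normalize-coprime (coprime-sym (1-coprimeTo n))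
  ℤ→ℚ-mkℚ -[1+ n ] = cong -_ (ℚP.normalize-coprime (coprime-sym (1-coprimeTo (suc n))))

  ℤ→ℚ-+ : ∀ a b → ℤ→ℚ (a ℤ.+ b) ≡ ℤ→ℚ a + ℤ→ℚ b
  ℤ→ℚ-+ a b rewrite ℤ→ℚ-mkℚ a | ℤ→ℚ-mkℚ b =
    cong ℤ→ℚ (cong₂ ℤ._+_ (sym (ℤP.*-identityʳ a)) (sym (ℤP.*-identityʳ b)))

  ℤ→ℚ-* : ∀ a b → ℤ→ℚ (a ℤ.* b) ≡ ℤ→ℚ a * ℤ→ℚ b
  ℤ→ℚ-* a b rewrite ℤ→ℚ-mkℚ a | ℤ→ℚ-mkℚ b = refl

  ℤ→ℚ-neg : ∀ a → ℤ→ℚ (ℤ.- a) ≡ - ℤ→ℚ a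
  ℤ→ℚ-neg a rewrite ℤ→ℚ-mkℚ a | ℤ→ℚ-mkℚ (ℤ.- a) = mkℚ-neg a
    where
    mkℚ-neg : ∀ a → mkℚ (ℤ.- a) 0 (coprime-sym (1-coprimeTo ℤ.∣ ℤ.- a ∣))
                  ≡ - mkℚ a 0 (coprime-sym (1-coprimeTo ℤ.∣ a ∣))
    mkℚ-neg (+ zero)  = refl
    mkℚ-neg (+ suc n) = refl
    mkℚ-neg -[1+ n ]  = refl

  ℕ→ℚ-+ : ∀ m n → ℕ→ℚ (m ℕ.+ n) ≡ ℕ→ℚ m + ℕ→ℚ n
  ℕ→ℚ-+ m n = trans (cong ℤ→ℚ (ℤP.pos-+ m n)) (ℤ→ℚ-+ (+ m) (+ n))

  ℕ→ℚ-* : ∀ m n → ℕ→ℚ (m ℕ.* n) ≡ ℕ→ℚ m * ℕ→ℚ n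
  ℕ→ℚ-* m n = trans (cong ℤ→ℚ (ℤP.pos-* m n)) (ℤ→ℚ-* (+ m) (+ n))

module Sums where
  open Q using (_+_)
  open import Data.Rational.Solver using (module +-*-Solver)
  open +-*-Solver using (solve; _:+_; _:=_)
  open ≡-Reasoning

  sumBelow-cong : ∀ n {f g : ℕ → ℚ} → (∀ i → i < n → f i ≡ g i) → sumBelow n f ≡ sumBelow n g
  sumBelow-cong zero    f≡g = refl
  sumBelow-cong (suc n) f≡g =
    cong₂ _+_ (sumBelow-cong n (λ i i<n → f≡g i (ℕP.m<n⇒m<1+n i<n))) (f≡g n ℕP.≤-refl)

  sumBelow-ext : ∀ n {f g : ℕ → ℚ} → (∀ i → f i ≡ g i) → sumBelow n f ≡ sumBelow n g
  sumBelow-ext n f≡g = sumBelow-cong n (λ i _ → f≡g i)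

  sumBelow-vanish : ∀ n {f : ℕ → ℚ} → (∀ i → i < n → f i ≡ 0ℚ) → sumBelow n f ≡ 0ℚ
  sumBelow-vanish zero    f≡0 = refl
  sumBelow-vanish (suc n) f≡0 =
    cong₂ _+_ (sumBelow-vanish n (λ i i<n → f≡0 i (ℕP.m<n⇒m<1+n i<n))) (f≡0 n ℕP.≤-refl)

  sumBelow-+ : ∀ n (f g : ℕ → ℚ) → sumBelow n (λ i → f i + g i) ≡ sumBelow n f + sumBelow n g
  sumBelow-+ zero    f g = refl
  sumBelow-+ (suc n) f g = begin
    sumBelow n (λ i → f i + g i) + (f n + g n)  ≡⟨ cong (_+ (f n + g n)) (sumBelow-+ n f g) ⟩
    (sumBelow n f + sumBelow n g) + (f n + g n) ≡⟨ solve 4 (λ a b c d → (a :+ b) :+ (c :+ d) := (a :+ c) :+ (b :+ d))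
                                                      refl (sumBelow n f) (sumBelow n g) (f n) (g n) ⟩
    (sumBelow n f + f n) + (sumBelow n g + g n) ∎

  sumBelow-*ˡ : ∀ n c (f : ℕ → ℚ) → sumBelow n (λ i → c * f i) ≡ c * sumBelow n f
  sumBelow-*ˡ zero    c f = sym (ℚP.*-zeroʳ c)
  sumBelow-*ˡ (suc n) c f =
    trans (cong (_+ c * f n) (sumBelow-*ˡ n c f)) (sym (ℚP.*-distribˡ-+ c (sumBelow n f) (f n)))

  sumBelow-*ʳ : ∀ n c (f : ℕ → ℚ) → sumBelow n (λ i → f i * c) ≡ sumBelow n f * c
  sumBelow-*ʳ n c f =
    trans (sumBelow-ext n (λ i → ℚP.*-comm (f i) c)) (trans (sumBelow-*ˡ n c f) (ℚP.*-comm c _))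

  sumBelow-neg : ∀ n (f : ℕ → ℚ) → sumBelow n (λ i → - f i) ≡ - sumBelow n f
  sumBelow-neg zero    f = refl
  sumBelow-neg (suc n) f =
    trans (cong (_+ - f n) (sumBelow-neg n f)) (sym (ℚP.neg-distrib-+ (sumBelow n f) (f n)))

  sumBelow-− : ∀ n (f g : ℕ → ℚ) → sumBelow n (λ i → f i - g i) ≡ sumBelow n f - sumBelow n g
  sumBelow-− n f g = trans (sumBelow-+ n f (λ i → - g i)) (cong (sumBelow n f +_) (sumBelow-neg n g))

  sumBelow-head : ∀ n (f : ℕ → ℚ) → sumBelow (suc n) f ≡ f 0 + sumBelow n (λ i → f (suc i))
  sumBelow-head zero    f = trans (ℚP.+-identityˡ (f 0)) (sym (ℚP.+-identityʳ (f 0)))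
  sumBelow-head (suc n) f = trans (cong (_+ f (suc n)) (sumBelow-head n f)) (ℚP.+-assoc (f 0) _ _)

  sumBelow-reverse : ∀ n (f : ℕ → ℚ) → sumBelow n f ≡ sumBelow n (λ i → f (n ∸ suc i))
  sumBelow-reverse zero    f = refl
  sumBelow-reverse (suc n) f = begin
    sumBelow n f + f n                     ≡⟨ cong (_+ f n) (sumBelow-reverse n f) ⟩
    sumBelow n (λ i → f (n ∸ suc i)) + f n ≡⟨ ℚP.+-comm _ (f n) ⟩
    f n + sumBelow n (λ i → f (n ∸ suc i)) ≡⟨ sym (sumBelow-head n (λ i → f (suc n ∸ suc i))) ⟩
    sumBelow (suc n) (λ i → f (suc n ∸ suc i)) ∎

  sumBelow-swap : ∀ a b (F : ℕ → ℕ → ℚ) →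
    sumBelow a (λ i → sumBelow b (F i)) ≡ sumBelow b (λ j → sumBelow a (λ i → F i j))
  sumBelow-swap zero    b F = sym (sumBelow-vanish b (λ _ _ → refl))
  sumBelow-swap (suc a) b F = trans (cong (_+ sumBelow b (F a)) (sumBelow-swap a b F))
    (sym (sumBelow-+ b (λ j → sumBelow a (λ i → F i j)) (F a)))

  sumBelow-truncate : ∀ {m n} {f : ℕ → ℚ} → m ≤ n → (∀ i → m ≤ i → i < n → f i ≡ 0ℚ) →
                      sumBelow n f ≡ sumBelow m f
  sumBelow-truncate {n = zero} z≤n _ = refl
  sumBelow-truncate {m} {suc n} {f} m≤1+n f≡0 with ℕP.m≤n⇒m<n∨m≡n m≤1+n
  ... | inj₂ refl = refl
  ... | inj₁ (s≤s m≤n) = begin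
    sumBelow n f + f n ≡⟨ cong₂ _+_ (sumBelow-truncate m≤n (λ i m≤i i<n → f≡0 i m≤i (ℕP.m<n⇒m<1+n i<n)))
                                    (f≡0 n m≤n ℕP.≤-refl) ⟩
    sumBelow m f + 0ℚ  ≡⟨ ℚP.+-identityʳ _ ⟩
    sumBelow m f       ∎

  sumTo-truncate : ∀ {m n} {f : ℕ → ℚ} → m ≤ n → (∀ i → m < i → i ≤ n → f i ≡ 0ℚ) → sumTo n f ≡ sumTo m f
  sumTo-truncate m≤n f≡0 = sumBelow-truncate (s≤s m≤n) (λ i m<i i≤n → f≡0 i m<i (ℕP.≤-pred i≤n))

  sumTo-antidiagonal : ∀ n (F : ℕ → ℕ → ℚ) →
    sumTo n (λ j → sumTo j (λ i → F i (j ∸ i))) ≡ sumTo n (λ i → sumTo (n ∸ i) (F i))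
  sumTo-antidiagonal zero    F = refl
  sumTo-antidiagonal (suc n) F = begin
    sumTo n (λ j → sumTo j (λ i → F i (j ∸ i))) + D
      ≡⟨ cong (_+ D) (sumTo-antidiagonal n F) ⟩
    S + (sumTo n (λ i → F i (suc n ∸ i)) + F (suc n) (n ∸ n))
      ≡⟨ cong (λ k → S + (sumTo n (λ i → F i (suc n ∸ i)) + F (suc n) k)) (ℕP.n∸n≡0 n) ⟩
    S + (sumTo n (λ i → F i (suc n ∸ i)) + F (suc n) 0)
      ≡⟨ sym (ℚP.+-assoc S _ _) ⟩
    (S + sumTo n (λ i → F i (suc n ∸ i))) + F (suc n) 0
      ≡⟨ cong (_+ F (suc n) 0) (sym (sumBelow-+ (suc n) _ _)) ⟩
    sumTo n (λ i → sumTo (n ∸ i) (F i) + F i (suc n ∸ i)) + F (suc n) 0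
      ≡⟨ cong₂ _+_ (sumBelow-cong (suc n) (λ i i≤n → sym (grow i (ℕP.≤-pred i≤n))))
                   (sym (ℚP.+-identityˡ _)) ⟩
    sumTo n (λ i → sumTo (suc n ∸ i) (F i)) + sumTo 0 (F (suc n))
      ≡⟨ cong (λ k → sumTo n (λ i → sumTo (suc n ∸ i) (F i)) + sumTo k (F (suc n))) (sym (ℕP.n∸n≡0 n)) ⟩
    sumTo (suc n) (λ i → sumTo (suc n ∸ i) (F i)) ∎
    where
    S = sumTo n (λ i → sumTo (n ∸ i) (F i))
    D = sumTo (suc n) (λ i → F i (suc n ∸ i))
    grow : ∀ i → i ≤ n → sumTo (suc n ∸ i) (F i) ≡ sumTo (n ∸ i) (F i) + F i (suc n ∸ i)
    grow i i≤n rewrite ℕP.+-∸-assoc 1 i≤n = refl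

  sumTo-triangle : ∀ n (F : ℕ → ℕ → ℚ) →
    sumTo n (λ i → sumTo (n ∸ i) (F i)) ≡ sumTo n (λ j → sumTo (n ∸ j) (λ i → F i j))
  sumTo-triangle n F = begin
    sumTo n (λ i → sumTo (n ∸ i) (F i))            ≡⟨ sym (sumTo-antidiagonal n F) ⟩
    sumTo n (λ j → sumTo j (λ i → F i (j ∸ i)))     ≡⟨ sumBelow-ext (suc n) reverse-inner ⟩
    sumTo n (λ j → sumTo j (λ i → F (j ∸ i) i))     ≡⟨ sumTo-antidiagonal n (λ j i → F i j) ⟩
    sumTo n (λ j → sumTo (n ∸ j) (λ i → F i j))     ∎
    where
    reverse-inner : ∀ j → sumTo j (λ i → F i (j ∸ i)) ≡ sumTo j (λ i → F (j ∸ i) i)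
    reverse-inner j = trans (sumBelow-reverse (suc j) _)
      (sumBelow-cong (suc j) (λ i i≤j → cong (F (j ∸ i)) (ℕP.m∸[m∸n]≡n (ℕP.≤-pred i≤j))))

module PowerSeries where
  open Sums
  open Q using (_+_)
  open import Data.Rational.Solver using (module +-*-Solver)
  open +-*-Solver using (solve; _:*_; _:=_)
  open import Algebra.Bundles using (CommutativeRing)
  open import Relation.Binary.Structures using (IsEquivalence)
  open ≡-Reasoning

  infix 4 _≈_
  _≈_ : PS → PS → Set
  a ≈ b = ∀ n → a n ≡ b n

  zeroPS : PS
  zeroPS n = 0ℚ

  negPS : PS → PS
  negPS a n = - a n

  X : PS
  X 1 = 1ℚ
  X _ = 0ℚ

  ≈-refl : ∀ {a} → a ≈ a
  ≈-refl n = refl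

  ≈-sym : ∀ {a b} → a ≈ b → b ≈ a
  ≈-sym p n = sym (p n)

  ≈-trans : ∀ {a b c} → a ≈ b → b ≈ c → a ≈ c
  ≈-trans p q n = trans (p n) (q n)

  ⊕-cong : ∀ {a a′ b b′} → a ≈ a′ → b ≈ b′ → (a ⊕ b) ≈ (a′ ⊕ b′)
  ⊕-cong p q n = cong₂ _+_ (p n) (q n)

  negPS-cong : ∀ {a b} → a ≈ b → negPS a ≈ negPS b
  negPS-cong p n = cong -_ (p n)

  ⊛-cong : ∀ {a a′ b b′} → a ≈ a′ → b ≈ b′ → (a ⊛ b) ≈ (a′ ⊛ b′)
  ⊛-cong p q n = sumBelow-ext (suc n) (λ i → cong₂ _*_ (p i) (q (n ∸ i)))

  ⊛-congˡ : ∀ a {b b′} → b ≈ b′ → (a ⊛ b) ≈ (a ⊛ b′)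
  ⊛-congˡ a = ⊛-cong {a} (λ _ → refl)

  ⊛-congʳ : ∀ b {a a′} → a ≈ a′ → (a ⊛ b) ≈ (a′ ⊛ b)
  ⊛-congʳ b p = ⊛-cong {b = b} p (λ _ → refl)

  ⊕-congˡ : ∀ a {b b′} → b ≈ b′ → (a ⊕ b) ≈ (a ⊕ b′)
  ⊕-congˡ a = ⊕-cong {a} (λ _ → refl)

  ⊕-congʳ : ∀ b {a a′} → a ≈ a′ → (a ⊕ b) ≈ (a′ ⊕ b)
  ⊕-congʳ b p = ⊕-cong {b = b} p (λ _ → refl)

  ⊛-cong-≤ : ∀ n a a′ b b′ → (∀ i → i ≤ n → a i ≡ a′ i) → (∀ i → i ≤ n → b i ≡ b′ i) →
             (a ⊛ b) n ≡ (a′ ⊛ b′) n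
  ⊛-cong-≤ n a a′ b b′ a≡ b≡ = sumBelow-cong (suc n) (λ i i≤n → cong₂ _*_ (a≡ i (ℕP.≤-pred i≤n)) (b≡ (n ∸ i) (ℕP.m∸n≤m n i)))

  ⊛-comm : ∀ a b → (a ⊛ b) ≈ (b ⊛ a)
  ⊛-comm a b n = begin
    sumTo n (λ i → a i * b (n ∸ i))             ≡⟨ sumBelow-reverse (suc n) _ ⟩
    sumTo n (λ i → a (n ∸ i) * b (n ∸ (n ∸ i))) ≡⟨ sumBelow-cong (suc n) (λ i i≤n →
                                                     trans (cong (λ k → a (n ∸ i) * b k) (ℕP.m∸[m∸n]≡n (ℕP.≤-pred i≤n)))
                                                           (ℚP.*-comm (a (n ∸ i)) (b i))) ⟩
    sumTo n (λ i → b i * a (n ∸ i))             ∎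

  ⊛-identityˡ : ∀ a → (oneS ⊛ a) ≈ a
  ⊛-identityˡ a n = begin
    sumBelow (suc n) (λ i → oneS i * a (n ∸ i))          ≡⟨ sumBelow-head n _ ⟩
    1ℚ * a n + sumBelow n (λ i → 0ℚ * a (n ∸ suc i))     ≡⟨ cong₂ _+_ (ℚP.*-identityˡ (a n))
                                                              (sumBelow-vanish n (λ i _ → ℚP.*-zeroˡ (a (n ∸ suc i)))) ⟩
    a n + 0ℚ                                             ≡⟨ ℚP.+-identityʳ _ ⟩
    a n                                                  ∎

  ⊛-identityʳ : ∀ a → (a ⊛ oneS) ≈ a
  ⊛-identityʳ a = ≈-trans (⊛-comm a oneS) (⊛-identityˡ a)

  ⊛-distribˡ : ∀ a b c → (a ⊛ (b ⊕ c)) ≈ ((a ⊛ b) ⊕ (a ⊛ c))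
  ⊛-distribˡ a b c n = trans (sumBelow-ext (suc n) (λ i → ℚP.*-distribˡ-+ (a i) (b (n ∸ i)) (c (n ∸ i))))
                             (sumBelow-+ (suc n) _ _)

  ⊛-distribʳ : ∀ a b c → ((b ⊕ c) ⊛ a) ≈ ((b ⊛ a) ⊕ (c ⊛ a))
  ⊛-distribʳ a b c = ≈-trans (⊛-comm (b ⊕ c) a)
    (≈-trans (⊛-distribˡ a b c) (⊕-cong (⊛-comm a b) (⊛-comm a c)))

  ⊛-rotate : ∀ a b c → (c ⊛ (a ⊛ b)) ≈ (a ⊛ (c ⊛ b))
  ⊛-rotate a b c n = begin
    sumTo n (λ i → c i * sumTo (n ∸ i) (λ j → a j * b (n ∸ i ∸ j)))
      ≡⟨ sumBelow-ext (suc n) (λ i → sym (sumBelow-*ˡ (suc (n ∸ i)) (c i) _)) ⟩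
    sumTo n (λ i → sumTo (n ∸ i) (λ j → c i * (a j * b (n ∸ i ∸ j))))
      ≡⟨ sumTo-triangle n (λ i j → c i * (a j * b (n ∸ i ∸ j))) ⟩
    sumTo n (λ j → sumTo (n ∸ j) (λ i → c i * (a j * b (n ∸ i ∸ j))))
      ≡⟨ sumBelow-ext (suc n) (λ j → sumBelow-ext (suc (n ∸ j)) (λ i → trans
            (cong (λ k → c i * (a j * b k)) (∸-exchange n i j))
            (solve 3 (λ x y z → x :* (y :* z) := y :* (x :* z)) refl (c i) (a j) (b (n ∸ j ∸ i))))) ⟩
    sumTo n (λ j → sumTo (n ∸ j) (λ i → a j * (c i * b (n ∸ j ∸ i))))
      ≡⟨ sumBelow-ext (suc n) (λ j → sumBelow-*ˡ (suc (n ∸ j)) (a j) _) ⟩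
    sumTo n (λ j → a j * sumTo (n ∸ j) (λ i → c i * b (n ∸ j ∸ i))) ∎
    where
    ∸-exchange : ∀ n i j → n ∸ i ∸ j ≡ n ∸ j ∸ i
    ∸-exchange n i j = trans (ℕP.∸-+-assoc n i j) (trans (cong (n ∸_) (ℕP.+-comm i j)) (sym (ℕP.∸-+-assoc n j i)))

  ⊛-assoc : ∀ a b c → ((a ⊛ b) ⊛ c) ≈ (a ⊛ (b ⊛ c))
  ⊛-assoc a b c = ≈-trans (⊛-comm (a ⊛ b) c) (≈-trans (⊛-rotate a b c) (⊛-congˡ a (⊛-comm c b)))

  ≈-isEquivalence : IsEquivalence _≈_
  ≈-isEquivalence = record { refl = λ {a} → ≈-refl {a} ; sym = ≈-sym ; trans = ≈-trans }

  PS-commutativeRing : CommutativeRing _ _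
  PS-commutativeRing = record
    { Carrier = PS ; _≈_ = _≈_ ; _+_ = _⊕_ ; _*_ = _⊛_ ; -_ = negPS ; 0# = zeroPS ; 1# = oneS
    ; isCommutativeRing = record
      { isRing = record
        { +-isAbelianGroup = record
          { isGroup = record
            { isMonoid = record
              { isSemigroup = record
                { isMagma = record { isEquivalence = ≈-isEquivalence ; ∙-cong = ⊕-cong }
                ; assoc = λ a b c n → ℚP.+-assoc (a n) (b n) (c n) }
              ; identity = (λ a n → ℚP.+-identityˡ (a n)) , (λ a n → ℚP.+-identityʳ (a n)) }
            ; inverse = (λ a n → ℚP.+-inverseˡ (a n)) , (λ a n → ℚP.+-inverseʳ (a n))
            ; ⁻¹-cong = negPS-cong }
          ; comm = λ a b n → ℚP.+-comm (a n) (b n) }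
        ; *-cong = ⊛-cong
        ; *-assoc = ⊛-assoc
        ; *-identity = ⊛-identityˡ , ⊛-identityʳ
        ; distrib = ⊛-distribˡ , ⊛-distribʳ }
      ; *-comm = ⊛-comm } }

  constPS-+ : ∀ a b → constPS (a + b) ≈ (constPS a ⊕ constPS b)
  constPS-+ a b zero    = refl
  constPS-+ a b (suc n) = refl

  constPS-− : ∀ a b → constPS (a - b) ≈ (constPS a ⊕ negPS (constPS b))
  constPS-− a b zero    = refl
  constPS-− a b (suc n) = refl

  constPS-neg : ∀ a → constPS (- a) ≈ negPS (constPS a)
  constPS-neg a zero    = refl
  constPS-neg a (suc n) = refl

  constPS-⊛ : ∀ c a n → (constPS c ⊛ a) n ≡ c * a n
  constPS-⊛ c a n = begin
    sumBelow (suc n) (λ i → constPS c i * a (n ∸ i))      ≡⟨ sumBelow-head n _ ⟩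
    c * a n + sumBelow n (λ i → 0ℚ * a (n ∸ suc i))       ≡⟨ cong (c * a n +_) (sumBelow-vanish n (λ i _ → ℚP.*-zeroˡ (a (n ∸ suc i)))) ⟩
    c * a n + 0ℚ                                          ≡⟨ ℚP.+-identityʳ _ ⟩
    c * a n                                               ∎

  constPS-* : ∀ a b → constPS (a * b) ≈ (constPS a ⊛ constPS b)
  constPS-* a b zero    = sym (constPS-⊛ a (constPS b) zero)
  constPS-* a b (suc n) = sym (trans (constPS-⊛ a (constPS b) (suc n)) (ℚP.*-zeroʳ a))

  ⊛-head : ∀ a b → (a ⊛ b) 0 ≡ a 0 * b 0
  ⊛-head a b = ℚP.+-identityˡ (a 0 * b 0)

  X⊛-head : ∀ a → (X ⊛ a) 0 ≡ 0ℚ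
  X⊛-head a = trans (⊛-head X a) (ℚP.*-zeroˡ (a 0))

  X⊛-suc : ∀ a n → (X ⊛ a) (suc n) ≡ a n
  X⊛-suc a n = begin
    sumBelow (suc (suc n)) (λ i → X i * a (suc n ∸ i))                ≡⟨ sumBelow-head (suc n) _ ⟩
    0ℚ * a (suc n) + sumBelow (suc n) (λ i → X (suc i) * a (n ∸ i))   ≡⟨ cong₂ _+_ (ℚP.*-zeroˡ (a (suc n)))
                                                                           (sumBelow-ext (suc n) (λ i → cong (_* a (n ∸ i)) (X-suc i))) ⟩
    0ℚ + (oneS ⊛ a) n                                                 ≡⟨ trans (ℚP.+-identityˡ _) (⊛-identityˡ a n) ⟩
    a n                                                               ∎
    where
    X-suc : ∀ i → X (suc i) ≡ oneS i
    X-suc zero    = refl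
    X-suc (suc i) = refl

  head+X⊛tail : ∀ a b → (∀ n → a (suc n) ≡ b n) → a ≈ (constPS (a 0) ⊕ (X ⊛ b))
  head+X⊛tail a b tail zero    = sym (trans (cong (a 0 +_) (X⊛-head b)) (ℚP.+-identityʳ (a 0)))
  head+X⊛tail a b tail (suc n) = sym (trans (cong (0ℚ +_) (X⊛-suc b n)) (trans (ℚP.+-identityˡ (b n)) (sym (tail n))))

  X⊛-injective : ∀ a b → (X ⊛ a) ≈ (X ⊛ b) → a ≈ b
  X⊛-injective a b Xa≈Xb n = trans (sym (X⊛-suc a n)) (trans (Xa≈Xb (suc n)) (X⊛-suc b n))

  module ≈-Reasoning where
    open import Relation.Binary.Reasoning.Setoid (CommutativeRing.setoid PS-commutativeRing) public

module PowerSeriesSolver where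
  open PowerSeries
  open import Data.Maybe using (Maybe; just; nothing)
  open import Relation.Nullary using (yes; no)
  open import Algebra.Solver.Ring.AlmostCommutativeRing
    using (AlmostCommutativeRing; fromCommutativeRing; _-Raw-AlmostCommutative⟶_)
  import Algebra.Solver.Ring as RingSolver

  private
    constPS-homomorphism : ℚP.+-*-rawRing -Raw-AlmostCommutative⟶ fromCommutativeRing PS-commutativeRing
    constPS-homomorphism = record
      { ⟦_⟧ = constPS ; +-homo = constPS-+ ; *-homo = constPS-* ; -‿homo = constPS-neg
      ; 0-homo = λ { zero → refl ; (suc n) → refl } ; 1-homo = λ n → refl }

    constPS-equal? : ∀ a b → Maybe (constPS a ≈ constPS b)
    constPS-equal? a b with a ℚP.≟ b
    ... | yes refl = just ≈-refl
    ... | no _     = nothing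

  open RingSolver ℚP.+-*-rawRing (fromCommutativeRing PS-commutativeRing) constPS-homomorphism constPS-equal? public

module CourseOfValues where
  open import Data.List using (List; []; _∷_; _++_; length)
  open import Data.List.Properties using (length-++)

  Causal : (ℕ → (ℕ → ℚ) → ℚ) → Set
  Causal step = ∀ n f g → (∀ i → i < n → f i ≡ g i) → step n f ≡ step n g

  cov-unfold : ∀ step → Causal step → ∀ n → cov step n ≡ step n (cov step)
  cov-unfold step causal n =
    trans (nth-snoc (table step n) _ n (sym (length-table n))) (causal n _ _ (nth-table n))
    where
    length-table : ∀ n → length (table step n) ≡ n
    length-table zero    = refl
    length-table (suc n) = trans (length-++ (table step n)) (trans (ℕP.+-comm _ 1) (cong suc (length-table n)))

    nth-++ : ∀ (xs ys : List ℚ) i → i < length xs → nth (xs ++ ys) i ≡ nth xs i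
    nth-++ (x ∷ xs) ys zero    _         = refl
    nth-++ (x ∷ xs) ys (suc i) (s≤s i<n) = nth-++ xs ys i i<n

    nth-snoc : ∀ (xs : List ℚ) y i → i ≡ length xs → nth (xs ++ y ∷ []) i ≡ y
    nth-snoc []       y zero    _ = refl
    nth-snoc (x ∷ xs) y (suc i) p = nth-snoc xs y i (ℕP.suc-injective p)

    nth-table : ∀ m i → i < m → nth (table step m) i ≡ cov step i
    nth-table (suc m) i i<1+m with ℕP.m≤n⇒m<n∨m≡n (ℕP.≤-pred i<1+m)
    ... | inj₁ i<m  = trans (nth-++ (table step m) _ i (subst (i <_) (sym (length-table m)) i<m)) (nth-table m i i<m)
    ... | inj₂ refl = refl

module InverseAndSquareRoot where
  open Sums
  open PowerSeries
  open CourseOfValues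
  open Q using (_+_)
  open import Data.Nat.Induction using (<-rec)
  open import Data.Rational.Solver using (module +-*-Solver)
  open +-*-Solver using (solve; _:+_; _:*_; :-_; _:-_; _:=_; con)

  invPS-suc : ∀ a n → invPS a (suc n) ≡ - sumBelow (suc n) (λ j → a (suc j) * invPS a (n ∸ j))
  invPS-suc a n = cov-unfold _ causal (suc n)
    where
    causal : Causal _
    causal zero    f g f≡g = refl
    causal (suc m) f g f≡g = cong -_ (sumBelow-ext (suc m) (λ j → cong (a (suc j) *_) (f≡g (m ∸ j) (s≤s (ℕP.m∸n≤m m j)))))

  invPS-inverseʳ : ∀ a → a 0 ≡ 1ℚ → (a ⊛ invPS a) ≈ oneS
  invPS-inverseʳ a a₀≡1 zero rewrite a₀≡1 = refl
  invPS-inverseʳ a a₀≡1 (suc m) = begin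
    sumBelow (suc (suc m)) (λ i → a i * invPS a (suc m ∸ i)) ≡⟨ sumBelow-head (suc m) _ ⟩
    a 0 * invPS a (suc m) + S                                ≡⟨ cong (λ c → c * invPS a (suc m) + S) a₀≡1 ⟩
    1ℚ * invPS a (suc m) + S                                 ≡⟨ cong (λ c → 1ℚ * c + S) (invPS-suc a m) ⟩
    1ℚ * (- S) + S                                           ≡⟨ solve 1 (λ s → con 1ℚ :* (:- s) :+ s := con 0ℚ) refl S ⟩
    0ℚ                                                       ∎
    where
    open ≡-Reasoning
    S = sumBelow (suc m) (λ j → a (suc j) * invPS a (m ∸ j))

  ⊛-cancelʳ : ∀ a b u → u 0 ≡ 1ℚ → (a ⊛ u) ≈ (b ⊛ u) → a ≈ b
  ⊛-cancelʳ a b u u₀≡1 au≈bu = begin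
    a                   ≈⟨ undo a ⟨
    (a ⊛ u) ⊛ invPS u   ≈⟨ ⊛-congʳ (invPS u) au≈bu ⟩
    (b ⊛ u) ⊛ invPS u   ≈⟨ undo b ⟩
    b                   ∎
    where
    open ≈-Reasoning
    undo : ∀ c → (c ⊛ u) ⊛ invPS u ≈ c
    undo c = begin
      (c ⊛ u) ⊛ invPS u ≈⟨ ⊛-assoc c u (invPS u) ⟩
      c ⊛ (u ⊛ invPS u) ≈⟨ ⊛-congˡ c (invPS-inverseʳ u u₀≡1) ⟩
      c ⊛ oneS          ≈⟨ ⊛-identityʳ c ⟩
      c                 ∎

  invPS-inverseˡ : ∀ a → a 0 ≡ 1ℚ → (invPS a ⊛ a) ≈ oneS
  invPS-inverseˡ a a₀≡1 = ≈-trans (⊛-comm (invPS a) a) (invPS-inverseʳ a a₀≡1)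

  invPS-unique : ∀ a u → a 0 ≡ 1ℚ → (u ⊛ a) ≈ oneS → u ≈ invPS a
  invPS-unique a u a₀≡1 ua≈1 = ⊛-cancelʳ u (invPS a) a a₀≡1 (≈-trans ua≈1 (≈-sym (invPS-inverseˡ a a₀≡1)))

  square-suc : ∀ (s : PS) m → (s ⊛ s) (suc m) ≡ s 0 * s (suc m) + (sumBelow m (λ j → s (suc j) * s (m ∸ j)) + s (suc m) * s 0)
  square-suc s m =
    trans (sumBelow-head (suc m) _) (cong (λ k → s 0 * s (suc m) + (sumBelow m (λ j → s (suc j) * s (m ∸ j)) + s (suc m) * s k)) (ℕP.n∸n≡0 m))

  sqrtPS-suc : ∀ a m → sqrtPS a (suc m) ≡ ½ * (a (suc m) - sumBelow m (λ j → sqrtPS a (suc j) * sqrtPS a (m ∸ j)))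
  sqrtPS-suc a m = cov-unfold _ causal (suc m)
    where
    causal : Causal _
    causal zero    f g f≡g = refl
    causal (suc m) f g f≡g = cong (λ t → ½ * (a (suc m) - t)) (sumBelow-cong m (λ j j<m →
      cong₂ _*_ (f≡g (suc j) (s≤s j<m)) (f≡g (m ∸ j) (s≤s (ℕP.m∸n≤m m j)))))

  sqrtPS-square : ∀ a → a 0 ≡ 1ℚ → (sqrtPS a ⊛ sqrtPS a) ≈ a
  sqrtPS-square a a₀≡1 zero    = sym a₀≡1
  sqrtPS-square a a₀≡1 (suc m) = begin
    (s ⊛ s) (suc m)                                                   ≡⟨ square-suc s m ⟩
    1ℚ * s (suc m) + (M + s (suc m) * 1ℚ)                             ≡⟨ cong (λ t → 1ℚ * t + (M + t * 1ℚ)) (sqrtPS-suc a m) ⟩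
    1ℚ * (½ * (a (suc m) - M)) + (M + (½ * (a (suc m) - M)) * 1ℚ)
      ≡⟨ solve 2 (λ a m → con 1ℚ :* (con ½ :* (a :- m)) :+ (m :+ (con ½ :* (a :- m)) :* con 1ℚ) := a)
               refl (a (suc m)) M ⟩
    a (suc m)                                                         ∎
    where
    open ≡-Reasoning
    s = sqrtPS a
    M = sumBelow m (λ j → s (suc j) * s (m ∸ j))

  sqrtPS-unique : ∀ a t → t 0 ≡ 1ℚ → (t ⊛ t) ≈ a → t ≈ sqrtPS a
  sqrtPS-unique a t t₀≡1 tt≈a = <-rec _ agree
    where
    open ≡-Reasoning
    agree : ∀ n → (∀ {i} → i < n → t i ≡ sqrtPS a i) → t n ≡ sqrtPS a n
    agree zero    _  = t₀≡1
    agree (suc m) ih = begin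
      t (suc m)
        ≡⟨ solve 2 (λ x m → x := con ½ :* ((con 1ℚ :* x :+ (m :+ x :* con 1ℚ)) :- m)) refl (t (suc m)) M ⟩
      ½ * ((1ℚ * t (suc m) + (M + t (suc m) * 1ℚ)) - M)            ≡⟨ cong (λ c → ½ * ((c * t (suc m) + (M + t (suc m) * c)) - M)) (sym t₀≡1) ⟩
      ½ * ((t 0 * t (suc m) + (M + t (suc m) * t 0)) - M)          ≡⟨ cong (λ c → ½ * (c - M)) (trans (sym (square-suc t m)) (tt≈a (suc m))) ⟩
      ½ * (a (suc m) - M)                                          ≡⟨ cong (λ c → ½ * (a (suc m) - c)) (sumBelow-cong m (λ j j<m →
                                                                        cong₂ _*_ (ih (s≤s j<m)) (ih (s≤s (ℕP.m∸n≤m m j))))) ⟩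
      ½ * (a (suc m) - sumBelow m (λ j → sqrtPS a (suc j) * sqrtPS a (m ∸ j))) ≡⟨ sqrtPS-suc a m ⟨
      sqrtPS a (suc m)                                             ∎
      where M = sumBelow m (λ j → t (suc j) * t (m ∸ j))

module Composition where
  open Sums
  open PowerSeries
  open InverseAndSquareRoot
  open Q using (_+_)
  open import Data.Rational.Solver using (module +-*-Solver)
  open +-*-Solver using (solve; _:+_; _:*_; _:=_; con)

  powPS-vanish : ∀ h → h 0 ≡ 0ℚ → ∀ j n → n < j → powPS h j n ≡ 0ℚ
  powPS-vanish h h₀≡0 (suc j) n (s≤s n≤j) = begin
    sumBelow (suc n) (λ i → h i * powPS h j (n ∸ i))                                 ≡⟨ sumBelow-head n _ ⟩
    h 0 * powPS h j n + sumBelow n (λ i → h (suc i) * powPS h j (n ∸ suc i))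
      ≡⟨ cong₂ _+_ (trans (cong (_* powPS h j n) h₀≡0) (ℚP.*-zeroˡ (powPS h j n)))
                   (sumBelow-vanish n (λ i i<n → trans (cong (h (suc i) *_) (powPS-vanish h h₀≡0 j (n ∸ suc i) (lower i i<n)))
                                                       (ℚP.*-zeroʳ (h (suc i))))) ⟩
    0ℚ + 0ℚ                                                                          ∎
    where
    open ≡-Reasoning
    lower : ∀ i → i < n → n ∸ suc i < j
    lower i i<n = ℕP.<-≤-trans (ℕP.∸-monoʳ-< (s≤s z≤n) i<n) n≤j

  powPS-+ : ∀ h i k → powPS h (i ℕ.+ k) ≈ (powPS h i ⊛ powPS h k)
  powPS-+ h zero    k = ≈-sym (⊛-identityˡ (powPS h k))
  powPS-+ h (suc i) k = ≈-trans (⊛-congˡ h (powPS-+ h i k)) (≈-sym (⊛-assoc h (powPS h i) (powPS h k)))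

  compose-cong : ∀ {f g} h → f ≈ g → compose f h ≈ compose g h
  compose-cong h f≈g n = sumBelow-ext (suc n) (λ j → cong (_* powPS h j n) (f≈g j))

  compose-head : ∀ f h → compose f h 0 ≡ f 0
  compose-head f h = trans (ℚP.+-identityˡ _) (ℚP.*-identityʳ (f 0))

  -- The sum over i may stop at n because hⁱ = O(xⁱ).
  compose-⊛-coeff : ∀ f h → h 0 ≡ 0ℚ → ∀ q n → (compose f h ⊛ q) n ≡ sumTo n (λ i → f i * (powPS h i ⊛ q) n)
  compose-⊛-coeff f h h₀≡0 q n = begin
    sumTo n (λ m → sumTo m (λ i → f i * powPS h i m) * q (n ∸ m))
      ≡⟨ sumBelow-ext (suc n) (λ m → sym (sumBelow-*ʳ (suc m) (q (n ∸ m)) _)) ⟩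
    sumTo n (λ m → sumTo m (λ i → f i * powPS h i m * q (n ∸ m)))
      ≡⟨ sumBelow-cong (suc n) (λ m m≤n → sym (sumTo-truncate (ℕP.≤-pred m≤n) (λ i m<i _ →
            trans (cong (λ c → f i * c * q (n ∸ m)) (powPS-vanish h h₀≡0 i m m<i))
                  (solve 2 (λ x y → x :* con 0ℚ :* y := con 0ℚ) refl (f i) (q (n ∸ m)))))) ⟩
    sumTo n (λ m → sumTo n (λ i → f i * powPS h i m * q (n ∸ m)))
      ≡⟨ sumBelow-swap (suc n) (suc n) _ ⟩
    sumTo n (λ i → sumTo n (λ m → f i * powPS h i m * q (n ∸ m)))
      ≡⟨ sumBelow-ext (suc n) (λ i → trans (sumBelow-ext (suc n) (λ m → ℚP.*-assoc (f i) _ _)) (sumBelow-*ˡ (suc n) (f i) _)) ⟩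
    sumTo n (λ i → f i * (powPS h i ⊛ q) n) ∎
    where open ≡-Reasoning

  compose-⊛ : ∀ f g h → h 0 ≡ 0ℚ → compose (f ⊛ g) h ≈ (compose f h ⊛ compose g h)
  compose-⊛ f g h h₀≡0 n = begin
    sumTo n (λ j → sumTo j (λ i → f i * g (j ∸ i)) * P j)
      ≡⟨ sumBelow-ext (suc n) (λ j → sym (sumBelow-*ʳ (suc j) (P j) _)) ⟩
    sumTo n (λ j → sumTo j (λ i → f i * g (j ∸ i) * P j))
      ≡⟨ sumBelow-cong (suc n) (λ j _ → sumBelow-cong (suc j) (λ i i≤j →
            cong (λ k → f i * g (j ∸ i) * P k) (sym (ℕP.m+[n∸m]≡n (ℕP.≤-pred i≤j))))) ⟩
    sumTo n (λ j → sumTo j (λ i → f i * g (j ∸ i) * P (i ℕ.+ (j ∸ i))))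
      ≡⟨ sumTo-antidiagonal n (λ i k → f i * g k * P (i ℕ.+ k)) ⟩
    sumTo n (λ i → sumTo (n ∸ i) (λ k → f i * g k * P (i ℕ.+ k)))
      ≡⟨ sumBelow-cong (suc n) (λ i i≤n → sym (sumTo-truncate (ℕP.m∸n≤m n i) (λ k n∸i<k _ →
            trans (cong (f i * g k *_) (powPS-vanish h h₀≡0 (i ℕ.+ k) n (beyond i k (ℕP.≤-pred i≤n) n∸i<k)))
                  (ℚP.*-zeroʳ (f i * g k))))) ⟩
    sumTo n (λ i → sumTo n (λ k → f i * g k * P (i ℕ.+ k)))
      ≡⟨ sumBelow-ext (suc n) (λ i → trans (sumBelow-ext (suc n) (λ k → trans (ℚP.*-assoc (f i) (g k) _)
            (cong (λ c → f i * (g k * c)) (trans (powPS-+ h i k n) (⊛-comm (powPS h i) (powPS h k) n)))))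
            (sumBelow-*ˡ (suc n) (f i) _)) ⟩
    sumTo n (λ i → f i * sumTo n (λ k → g k * (powPS h k ⊛ powPS h i) n))
      ≡⟨ sumBelow-ext (suc n) (λ i → cong (f i *_)
            (trans (sym (compose-⊛-coeff g h h₀≡0 (powPS h i) n)) (⊛-comm (compose g h) (powPS h i) n))) ⟩
    sumTo n (λ i → f i * (powPS h i ⊛ compose g h) n)
      ≡⟨ sym (compose-⊛-coeff f h h₀≡0 (compose g h) n) ⟩
    (compose f h ⊛ compose g h) n ∎
    where
    open ≡-Reasoning
    P : ℕ → ℚ
    P j = powPS h j n
    beyond : ∀ i k → i ≤ n → n ∸ i < k → n < i ℕ.+ k
    beyond i k i≤n n∸i<k = subst (_< i ℕ.+ k) (ℕP.m+[n∸m]≡n i≤n) (ℕP.+-monoʳ-< i n∸i<k)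

  compose-⊕ : ∀ f g h → compose (f ⊕ g) h ≈ (compose f h ⊕ compose g h)
  compose-⊕ f g h n = trans (sumBelow-ext (suc n) (λ j → ℚP.*-distribʳ-+ (powPS h j n) (f j) (g j))) (sumBelow-+ (suc n) _ _)

  compose-constPS : ∀ c h → compose (constPS c) h ≈ constPS c
  compose-constPS c h zero    = compose-head (constPS c) h
  compose-constPS c h (suc n) = trans (sumBelow-head (suc n) _)
    (cong₂ _+_ (ℚP.*-zeroʳ c) (sumBelow-vanish (suc n) (λ j _ → ℚP.*-zeroˡ (powPS h (suc j) (suc n)))))

  compose-X : ∀ h → h 0 ≡ 0ℚ → compose X h ≈ h
  compose-X h h₀≡0 zero    = trans (compose-head X h) (sym h₀≡0)
  compose-X h h₀≡0 (suc n) = begin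
    sumBelow (suc (suc n)) (λ j → X j * powPS h j (suc n))
      ≡⟨ sumBelow-head (suc n) _ ⟩
    0ℚ * 0ℚ + sumBelow (suc n) (λ j → X (suc j) * powPS h (suc j) (suc n))
      ≡⟨ cong (0ℚ * 0ℚ +_) (sumBelow-head n _) ⟩
    0ℚ * 0ℚ + (1ℚ * powPS h 1 (suc n) + sumBelow n (λ j → 0ℚ * powPS h (suc (suc j)) (suc n)))
      ≡⟨ cong (λ t → 0ℚ * 0ℚ + (1ℚ * powPS h 1 (suc n) + t)) (sumBelow-vanish n (λ j _ → ℚP.*-zeroˡ (powPS h (suc (suc j)) (suc n)))) ⟩
    0ℚ * 0ℚ + (1ℚ * powPS h 1 (suc n) + 0ℚ)
      ≡⟨ solve 1 (λ y → con 0ℚ :* con 0ℚ :+ (con 1ℚ :* y :+ con 0ℚ) := y) refl (powPS h 1 (suc n)) ⟩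
    powPS h 1 (suc n)
      ≡⟨ ⊛-identityʳ h (suc n) ⟩
    h (suc n) ∎
    where open ≡-Reasoning

  compose-invPS : ∀ f h → f 0 ≡ 1ℚ → h 0 ≡ 0ℚ → compose (invPS f) h ≈ invPS (compose f h)
  compose-invPS f h f₀≡1 h₀≡0 = invPS-unique (compose f h) (compose (invPS f) h) (trans (compose-head f h) f₀≡1) (begin
    compose (invPS f) h ⊛ compose f h ≈⟨ compose-⊛ (invPS f) f h h₀≡0 ⟨
    compose (invPS f ⊛ f) h           ≈⟨ compose-cong h (invPS-inverseˡ f f₀≡1) ⟩
    compose oneS h                    ≈⟨ compose-constPS 1ℚ h ⟩
    oneS                              ∎)
    where open ≈-Reasoning

  quartic : PS → PS → PS → PS → PS → PS → PS
  quartic a₀ a₁ a₂ a₃ a₄ y = a₀ ⊕ (y ⊛ (a₁ ⊕ (y ⊛ (a₂ ⊕ (y ⊛ (a₃ ⊕ (y ⊛ a₄)))))))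

  quartic-cong : ∀ {a₀ a₁ a₂ a₃ a₄ b₀ b₁ b₂ b₃ b₄} y → a₀ ≈ b₀ → a₁ ≈ b₁ → a₂ ≈ b₂ → a₃ ≈ b₃ → a₄ ≈ b₄ →
                 quartic a₀ a₁ a₂ a₃ a₄ y ≈ quartic b₀ b₁ b₂ b₃ b₄ y
  quartic-cong y e₀ e₁ e₂ e₃ e₄ = ⊕-cong e₀ (⊛-congˡ y (⊕-cong e₁ (⊛-congˡ y (⊕-cong e₂ (⊛-congˡ y (⊕-cong e₃ (⊛-congˡ y e₄)))))))

  private
    linear-X-head : ∀ c a → (c ⊕ (X ⊛ a)) 0 ≡ c 0
    linear-X-head c a = trans (cong (c 0 +_) (X⊛-head a)) (ℚP.+-identityʳ (c 0))

    linear-X-suc : ∀ c a n → (constPS c ⊕ (X ⊛ a)) (suc n) ≡ a n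
    linear-X-suc c a n = trans (cong (0ℚ +_) (X⊛-suc a n)) (ℚP.+-identityˡ (a n))

    compose-linear : ∀ c a b h → h 0 ≡ 0ℚ → compose a h ≈ b → compose (constPS c ⊕ (X ⊛ a)) h ≈ (constPS c ⊕ (h ⊛ b))
    compose-linear c a b h h₀≡0 ah≈b = ≈-trans (compose-⊕ (constPS c) (X ⊛ a) h)
      (⊕-cong (compose-constPS c h) (≈-trans (compose-⊛ X a h h₀≡0) (⊛-cong (compose-X h h₀≡0) ah≈b)))

  module _ (c₀ c₁ c₂ c₃ c₄ : ℚ) where
    private
      H₃ H₂ H₁ : PS
      H₃ = constPS c₃ ⊕ (X ⊛ constPS c₄)
      H₂ = constPS c₂ ⊕ (X ⊛ H₃)
      H₁ = constPS c₁ ⊕ (X ⊛ H₂)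

      beyond-cubic : ∀ n → (constPS c₀ ⊕ (X ⊛ H₁)) (4 ℕ.+ n) ≡ constPS c₄ n
      beyond-cubic n = trans (linear-X-suc c₀ H₁ (3 ℕ.+ n)) (trans (linear-X-suc c₁ H₂ (2 ℕ.+ n))
                         (trans (linear-X-suc c₂ H₃ (1 ℕ.+ n)) (linear-X-suc c₃ (constPS c₄) n)))

    poly4-at-X : poly4 c₀ c₁ c₂ c₃ c₄ ≈ quartic (constPS c₀) (constPS c₁) (constPS c₂) (constPS c₃) (constPS c₄) X
    poly4-at-X 0 = sym (linear-X-head (constPS c₀) H₁)
    poly4-at-X 1 = sym (trans (linear-X-suc c₀ H₁ 0) (linear-X-head (constPS c₁) H₂))
    poly4-at-X 2 = sym (trans (linear-X-suc c₀ H₁ 1) (trans (linear-X-suc c₁ H₂ 0) (linear-X-head (constPS c₂) H₃)))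
    poly4-at-X 3 = sym (trans (linear-X-suc c₀ H₁ 2) (trans (linear-X-suc c₁ H₂ 1)
                        (trans (linear-X-suc c₂ H₃ 0) (linear-X-head (constPS c₃) (constPS c₄)))))
    poly4-at-X 4 = sym (beyond-cubic 0)
    poly4-at-X (suc (suc (suc (suc (suc n))))) = sym (beyond-cubic (suc n))

    compose-poly4 : ∀ h → h 0 ≡ 0ℚ →
      compose (poly4 c₀ c₁ c₂ c₃ c₄) h ≈ quartic (constPS c₀) (constPS c₁) (constPS c₂) (constPS c₃) (constPS c₄) h
    compose-poly4 h h₀≡0 = ≈-trans (compose-cong h poly4-at-X)
      (compose-linear c₀ H₁ _ h h₀≡0 (compose-linear c₁ H₂ _ h h₀≡0 (compose-linear c₂ H₃ _ h h₀≡0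
        (compose-linear c₃ (constPS c₄) _ h h₀≡0 (compose-constPS c₄ h)))))

module RiordanColumns (p q : ℚ) where
  open PowerSeries
  open CourseOfValues
  open Composition using (powPS-vanish)
  open Q using (_+_)

  kernel : PS → PS
  kernel w = (oneS ⊕ (constPS p ⊛ w)) ⊕ (constPS q ⊛ (w ⊛ w))

  private
    kernelStep : ℕ → (ℕ → ℚ) → ℚ
    kernelStep zero    w = 0ℚ
    kernelStep (suc n) w = kernel w n

    kernelStep-causal : Causal kernelStep
    kernelStep-causal zero    f g _   = refl
    kernelStep-causal (suc n) f g f≡g =
      cong₂ _+_ (cong (oneS n +_) (⊛-cong-≤ n (constPS p) (constPS p) f g (λ _ _ → refl) agree))
                (⊛-cong-≤ n (constPS q) (constPS q) (f ⊛ f) (g ⊛ g) (λ _ _ → refl)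
                   (λ i i≤n → ⊛-cong-≤ i f g f g (λ j j≤i → agree j (ℕP.≤-trans j≤i i≤n)) (λ j j≤i → agree j (ℕP.≤-trans j≤i i≤n))))
      where
      agree : ∀ i → i ≤ n → f i ≡ g i
      agree i i≤n = f≡g i (s≤s i≤n)

  kernelRoot : PS
  kernelRoot = cov kernelStep

  kernelRoot-equation : kernelRoot ≈ (X ⊛ kernel kernelRoot)
  kernelRoot-equation zero    = trans (cov-unfold _ kernelStep-causal zero) (sym (X⊛-head (kernel kernelRoot)))
  kernelRoot-equation (suc n) = trans (cov-unfold _ kernelStep-causal (suc n)) (sym (X⊛-suc (kernel kernelRoot) n))

  kernelRoot-head : kernelRoot 0 ≡ 0ℚ
  kernelRoot-head = refl

  -- The recurrence makes A a Riordan array with A-sequence (1, p, q).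
  riordan-columns : (A : ℕ → ℕ → ℚ) → (∀ j → A (suc j) 0 ≡ 0ℚ) →
    (∀ j n → A (suc j) (suc n) ≡ A j n + p * A (suc j) n + q * A (suc (suc j)) n) →
    ∀ j n → A j n ≡ (powPS kernelRoot j ⊛ A 0) n
  riordan-columns A A-top A-rec = columns
    where
    open PowerSeriesSolver using (solve; _:+_; _:*_; _:=_; con)
    w = kernelRoot
    C : ℕ → PS
    C j = powPS w j ⊛ A 0

    recurrent : ℕ → PS
    recurrent j = (C j ⊕ (constPS p ⊛ C (suc j))) ⊕ (constPS q ⊛ C (suc (suc j)))

    C-suc : ∀ j → C (suc j) ≈ (X ⊛ recurrent j)
    C-suc j = ≈-trans (⊛-congʳ (A 0) (⊛-congʳ (powPS w j) kernelRoot-equation))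
      (solve 6 (λ w x c a cp cq → ((x :* ((con 1ℚ :+ cp :* w) :+ cq :* (w :* w))) :* c) :* a
                               := x :* ((c :* a :+ cp :* ((w :* c) :* a)) :+ cq :* ((w :* (w :* c)) :* a)))
             (λ _ → refl) w X (powPS w j) (A 0) (constPS p) (constPS q))

    columns : ∀ j n → A j n ≡ C j n
    columns zero    n       = sym (⊛-identityˡ (A 0) n)
    columns (suc j) zero    = trans (A-top j) (sym (trans (⊛-head (powPS w (suc j)) (A 0))
                                (trans (cong (_* A 0 0) (powPS-vanish w kernelRoot-head (suc j) 0 (s≤s z≤n))) (ℚP.*-zeroˡ (A 0 0)))))
    columns (suc j) (suc n) = begin
      A (suc j) (suc n)                                        ≡⟨ A-rec j n ⟩
      A j n + p * A (suc j) n + q * A (suc (suc j)) n          ≡⟨ cong₂ _+_ (cong₂ _+_ (columns j n) (cong (p *_) (columns (suc j) n)))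
                                                                            (cong (q *_) (columns (suc (suc j)) n)) ⟩
      C j n + p * C (suc j) n + q * C (suc (suc j)) n          ≡⟨ sym (cong₂ _+_ (cong (C j n +_) (constPS-⊛ p (C (suc j)) n))
                                                                                (constPS-⊛ q (C (suc (suc j))) n)) ⟩
      recurrent j n                                            ≡⟨ sym (X⊛-suc (recurrent j) n) ⟩
      (X ⊛ recurrent j) (suc n)                                ≡⟨ sym (C-suc j (suc n)) ⟩
      C (suc j) (suc n)                                        ∎
      where open ≡-Reasoning

module Binomials where
  open Casts
  open Q using (_+_; mkℚ)
  open import Data.Nat.Combinatorics using (_C_; nCk+nC[k+1]≡[n+1]C[k+1]; nC1≡n)
  open import Data.Integer using (+_)
  import Data.Integer.Properties as ℤP
  open import Data.Nat.Coprimality using (1-coprimeTo) renaming (sym to coprime-sym)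
  open import Data.Rational.Solver using (module +-*-Solver)
  open +-*-Solver using (solve; _:+_; _:*_; _:-_; _:=_; con)
  import Data.Nat.Solver as ℕS
  open ℕS.+-*-Solver using () renaming (solve to solveℕ; _:+_ to _:+ℕ_; _:*_ to _:*ℕ_; _:=_ to _:=ℕ_; con to conℕ)
  open ≡-Reasoning

  pascal : ∀ n k → suc n C suc k ≡ n C k ℕ.+ n C suc k
  pascal n k = sym (nCk+nC[k+1]≡[n+1]C[k+1] n k)

  absorption : ∀ n k → suc k ℕ.* (suc n C suc k) ≡ suc n ℕ.* (n C k)
  absorption zero    zero    = refl
  absorption zero    (suc k) = ℕP.*-zeroʳ (suc (suc k))
  absorption (suc n) zero    = trans (ℕP.*-identityˡ (suc (suc n) C 1)) (trans (nC1≡n (suc (suc n))) (sym (ℕP.*-identityʳ (suc (suc n)))))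
  absorption (suc n) (suc k) = begin
    suc (suc k) ℕ.* (suc (suc n) C suc (suc k))          ≡⟨ cong (suc (suc k) ℕ.*_) (pascal (suc n) (suc k)) ⟩
    suc (suc k) ℕ.* (a ℕ.+ b)                            ≡⟨ solveℕ 3 (λ k a b → (conℕ 2 :+ℕ k) :*ℕ (a :+ℕ b)
                                                               :=ℕ ((conℕ 1 :+ℕ k) :*ℕ a :+ℕ a) :+ℕ (conℕ 2 :+ℕ k) :*ℕ b) refl k a b ⟩
    (suc k ℕ.* a ℕ.+ a) ℕ.+ suc (suc k) ℕ.* b            ≡⟨ cong₂ (λ x y → (x ℕ.+ a) ℕ.+ y) (absorption n k) (absorption n (suc k)) ⟩
    (suc n ℕ.* (n C k) ℕ.+ a) ℕ.+ suc n ℕ.* (n C suc k)  ≡⟨ solveℕ 4 (λ n x y a → ((conℕ 1 :+ℕ n) :*ℕ x :+ℕ a) :+ℕ (conℕ 1 :+ℕ n) :*ℕ y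
                                                               :=ℕ (conℕ 1 :+ℕ n) :*ℕ (x :+ℕ y) :+ℕ a) refl n (n C k) (n C suc k) a ⟩
    suc n ℕ.* (n C k ℕ.+ n C suc k) ℕ.+ a                ≡⟨ cong (λ z → suc n ℕ.* z ℕ.+ a) (sym (pascal n k)) ⟩
    suc n ℕ.* a ℕ.+ a                                    ≡⟨ solveℕ 2 (λ n a → (conℕ 1 :+ℕ n) :*ℕ a :+ℕ a :=ℕ (conℕ 2 :+ℕ n) :*ℕ a) refl n a ⟩
    suc (suc n) ℕ.* (suc n C suc k)                      ∎
    where a = suc n C suc k
          b = suc n C suc (suc k)

  binom : ℕ → ℕ → ℚ
  binom n k = ℕ→ℚ (n C k)

  binom-absorption : ∀ n k → ℕ→ℚ (suc k) * binom n (suc k) + ℕ→ℚ (suc k) * binom n k ≡ ℕ→ℚ (suc n) * binom n k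
  binom-absorption n k = begin
    ℕ→ℚ (suc k) * binom n (suc k) + ℕ→ℚ (suc k) * binom n k ≡⟨ sym (ℚP.*-distribˡ-+ (ℕ→ℚ (suc k)) (binom n (suc k)) (binom n k)) ⟩
    ℕ→ℚ (suc k) * (binom n (suc k) + binom n k)             ≡⟨ cong (ℕ→ℚ (suc k) *_) (sym (ℕ→ℚ-+ (n C suc k) (n C k))) ⟩
    ℕ→ℚ (suc k) * ℕ→ℚ (n C suc k ℕ.+ n C k)                 ≡⟨ sym (ℕ→ℚ-* (suc k) (n C suc k ℕ.+ n C k)) ⟩
    ℕ→ℚ (suc k ℕ.* (n C suc k ℕ.+ n C k))
      ≡⟨ cong (λ z → ℕ→ℚ (suc k ℕ.* z)) (trans (ℕP.+-comm (n C suc k) (n C k)) (sym (pascal n k))) ⟩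
    ℕ→ℚ (suc k ℕ.* (suc n C suc k))                         ≡⟨ cong ℕ→ℚ (absorption n k) ⟩
    ℕ→ℚ (suc n ℕ.* (n C k))                                 ≡⟨ ℕ→ℚ-* (suc n) (n C k) ⟩
    ℕ→ℚ (suc n) * binom n k                                 ∎

  /-suc-unique : ∀ m k q → ℕ→ℚ m ≡ ℕ→ℚ (suc k) * q → (+ m) Q./ suc k ≡ q
  /-suc-unique m k q m≡[1+k]q = begin
    (+ m) Q./ suc k                  ≡⟨ as-product ⟩
    ℕ→ℚ m * 1/[1+k]                  ≡⟨ cong (_* 1/[1+k]) m≡[1+k]q ⟩
    ℕ→ℚ (suc k) * q * 1/[1+k]        ≡⟨ solve 3 (λ a q i → a :* q :* i := q :* (a :* i)) refl (ℕ→ℚ (suc k)) q 1/[1+k] ⟩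
    q * (ℕ→ℚ (suc k) * 1/[1+k])      ≡⟨ cong (q *_) inverse ⟩
    q * 1ℚ                           ≡⟨ ℚP.*-identityʳ q ⟩
    q                                ∎
    where
    1/[1+k] : ℚ
    1/[1+k] = mkℚ (+ 1) k (1-coprimeTo (suc k))
    as-product : (+ m) Q./ suc k ≡ ℕ→ℚ m * 1/[1+k]
    as-product rewrite ℤ→ℚ-mkℚ (+ m) = sym (ℚP./-cong (ℤP.*-identityʳ (+ m)) (ℕP.*-identityˡ (suc k)))
    inverse : ℕ→ℚ (suc k) * 1/[1+k] ≡ 1ℚ
    inverse rewrite ℤ→ℚ-mkℚ (+ suc k) = ℚP.*-inverseʳ (mkℚ (+ suc k) 0 (coprime-sym (1-coprimeTo (suc k))))

  -- This form avoids the division in the definition of narayana.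
  narayana-suc : ∀ n k → narayana n (suc k) ≡ binom n (suc k) * binom n (suc k) - binom n (suc (suc k)) * binom n k
  narayana-suc n k = /-suc-unique ((n C suc k) ℕ.* (suc n C suc k)) (suc k) _ (sym (begin
    K₁ * (x * x - y * z)
      ≡⟨ solve 4 (λ K₁ x y z → K₁ :* (x :* x :- y :* z) := K₁ :* x :* x :- (K₁ :* y) :* z) refl K₁ x y z ⟩
    K₁ * x * x - (K₁ * y) * z                                  ≡⟨ cong (λ t → K₁ * x * x - t * z) K₁y ⟩
    K₁ * x * x - (N₁ * x - K₁ * x) * z                         ≡⟨ solve 4 (λ K₁ x N₁ z → K₁ :* x :* x :- (N₁ :* x :- K₁ :* x) :* z
                                                                              := K₁ :* x :* x :- x :* (N₁ :* z) :+ K₁ :* x :* z) refl K₁ x N₁ z ⟩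
    K₁ * x * x - x * (N₁ * z) + K₁ * x * z                     ≡⟨ cong (λ t → K₁ * x * x - x * t + K₁ * x * z) (sym (binom-absorption n k)) ⟩
    K₁ * x * x - x * (K * x + K * z) + K₁ * x * z              ≡⟨ cong (λ t → t * x * x - x * (K * x + K * z) + t * x * z) (ℕ→ℚ-+ 1 (suc k)) ⟩
    (1ℚ + K) * x * x - x * (K * x + K * z) + (1ℚ + K) * x * z
      ≡⟨ solve 3 (λ K x z → (con 1ℚ :+ K) :* x :* x :- x :* (K :* x :+ K :* z) :+ (con 1ℚ :+ K) :* x :* z
               := x :* (z :+ x)) refl K x z ⟩
    x * (z + x)                                                ≡⟨ cong (x *_) (sym (ℕ→ℚ-+ (n C k) (n C suc k))) ⟩
    x * ℕ→ℚ (n C k ℕ.+ n C suc k)                              ≡⟨ cong (λ t → x * ℕ→ℚ t) (sym (pascal n k)) ⟩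
    x * ℕ→ℚ (suc n C suc k)                                    ≡⟨ sym (ℕ→ℚ-* (n C suc k) (suc n C suc k)) ⟩
    ℕ→ℚ ((n C suc k) ℕ.* (suc n C suc k))                      ∎))
    where
    x = binom n (suc k)
    y = binom n (suc (suc k))
    z = binom n k
    K = ℕ→ℚ (suc k)
    K₁ = ℕ→ℚ (suc (suc k))
    N₁ = ℕ→ℚ (suc n)
    K₁y : K₁ * y ≡ N₁ * x - K₁ * x
    K₁y = trans (solve 2 (λ a b → a := (a :+ b) :- b) refl (K₁ * y) (K₁ * x)) (cong (_- K₁ * x) (binom-absorption n (suc k)))

module CentralColumns where
  open Casts
  open Binomials
  open Q using (_+_)
  open import Data.Nat.Combinatorics using (_C_; k>n⇒nCk≡0; nCk≡nC[n∸k])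
  open import Data.Rational.Solver using (module +-*-Solver)
  open +-*-Solver using (solve; _:+_; _:*_; _:=_; con)
  open ≡-Reasoning

  centralColumn : ℕ → ℕ → ℚ
  centralColumn j n = binom (n ℕ.+ n) (j ℕ.+ n)

  private
    double-suc : ∀ n → suc n ℕ.+ suc n ≡ suc (suc (n ℕ.+ n))
    double-suc n = cong suc (ℕP.+-suc n n)

  centralColumn-rec : ∀ j n → centralColumn (suc j) (suc n) ≡
    centralColumn j n + ℕ→ℚ 2 * centralColumn (suc j) n + 1ℚ * centralColumn (suc (suc j)) n
  centralColumn-rec j n = begin
    ℕ→ℚ ((suc n ℕ.+ suc n) C (suc j ℕ.+ suc n))                 ≡⟨ cong₂ (λ a b → ℕ→ℚ (a C b)) (double-suc n) (cong suc (ℕP.+-suc j n)) ⟩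
    ℕ→ℚ (suc (suc T) C suc (suc m))
      ≡⟨ cong ℕ→ℚ (trans (pascal (suc T) (suc m)) (cong₂ ℕ._+_ (pascal T m) (pascal T (suc m)))) ⟩
    ℕ→ℚ ((T C m ℕ.+ T C suc m) ℕ.+ (T C suc m ℕ.+ T C suc (suc m)))
      ≡⟨ trans (ℕ→ℚ-+ (T C m ℕ.+ T C suc m) _) (cong₂ _+_ (ℕ→ℚ-+ (T C m) _) (ℕ→ℚ-+ (T C suc m) _)) ⟩
    (a + b) + (b + c)
      ≡⟨ solve 3 (λ a b c → (a :+ b) :+ (b :+ c) := a :+ con (ℕ→ℚ 2) :* b :+ con 1ℚ :* c) refl a b c ⟩
    a + ℕ→ℚ 2 * b + 1ℚ * c                                      ∎
    where T = n ℕ.+ n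
          m = j ℕ.+ n
          a = binom T m
          b = binom T (suc m)
          c = binom T (suc (suc m))

  centralColumn-rec₀ : ∀ n → centralColumn 0 (suc n) ≡ ℕ→ℚ 2 * centralColumn 0 n + ℕ→ℚ 2 * centralColumn 1 n
  centralColumn-rec₀ n = begin
    ℕ→ℚ ((suc n ℕ.+ suc n) C suc n)                            ≡⟨ cong (λ a → ℕ→ℚ (a C suc n)) (double-suc n) ⟩
    ℕ→ℚ (suc (suc T) C suc n)                                  ≡⟨ cong ℕ→ℚ (pascal (suc T) n) ⟩
    ℕ→ℚ (suc T C n ℕ.+ suc T C suc n)                          ≡⟨ cong (λ z → ℕ→ℚ (z ℕ.+ suc T C suc n)) symmetry ⟩
    ℕ→ℚ (suc T C suc n ℕ.+ suc T C suc n)                      ≡⟨ cong (λ z → ℕ→ℚ (z ℕ.+ z)) (pascal T n) ⟩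
    ℕ→ℚ ((T C n ℕ.+ T C suc n) ℕ.+ (T C n ℕ.+ T C suc n))
      ≡⟨ trans (ℕ→ℚ-+ (T C n ℕ.+ T C suc n) _) (cong₂ _+_ (ℕ→ℚ-+ (T C n) _) (ℕ→ℚ-+ (T C n) _)) ⟩
    (a + b) + (a + b)
      ≡⟨ solve 2 (λ a b → (a :+ b) :+ (a :+ b) := con (ℕ→ℚ 2) :* a :+ con (ℕ→ℚ 2) :* b) refl a b ⟩
    ℕ→ℚ 2 * a + ℕ→ℚ 2 * b                                      ∎
    where T = n ℕ.+ n
          a = binom T n
          b = binom T (suc n)
          symmetry : suc T C n ≡ suc T C suc n
          symmetry = trans (nCk≡nC[n∸k] (ℕP.≤-trans (ℕP.m≤m+n n n) (ℕP.n≤1+n T)))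
                           (cong (suc T C_) (trans (ℕP.+-∸-assoc 1 (ℕP.m≤n+m n n)) (cong suc (ℕP.m+n∸n≡m n n))))

  centralColumn-vanish : ∀ i n → n < i → centralColumn i n ≡ 0ℚ
  centralColumn-vanish i n n<i = cong ℕ→ℚ (k>n⇒nCk≡0 (ℕP.+-monoˡ-< n n<i))

module Parameter (r : ℕ) where
  ρ : ℚ
  ρ = ℕ→ℚ r

  R : PS
  R = constPS ρ

module NarayanaColumns (r : ℕ) where
  open Parameter r using (ρ)
  open Casts
  open Sums
  open Binomials
  open Q using (_+_)
  open import Data.Nat.Combinatorics using (_C_; k>n⇒nCk≡0)
  open import Data.Rational.Solver using (module +-*-Solver)
  open +-*-Solver using (solve; _:+_; _:*_; _:-_; _:=_; con)
  open ≡-Reasoning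

  rpow : ℕ → ℚ
  rpow k = ℕ→ℚ (r ℕ.^ k)

  rpow-suc : ∀ k → rpow (suc k) ≡ ρ * rpow k
  rpow-suc k = ℕ→ℚ-* r (r ℕ.^ k)

  summand : ℕ → ℕ → ℕ → ℚ
  summand n j k = binom n k * binom n (j ℕ.+ k) * rpow k

  narayanaColumn : ℕ → ℕ → ℚ
  narayanaColumn j n = sumTo n (summand n j)

  private
    binom-vanish : ∀ {n k} → n < k → binom n k ≡ 0ℚ
    binom-vanish n<k = cong ℕ→ℚ (k>n⇒nCk≡0 n<k)

    binom-+-suc : ∀ n j k → binom n (j ℕ.+ suc k) ≡ binom n (suc (j ℕ.+ k))
    binom-+-suc n j k = cong (binom n) (ℕP.+-suc j k)

    summand-head : ∀ n j → summand n j 0 ≡ binom n j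
    summand-head n j = trans (cong (λ i → 1ℚ * binom n i * 1ℚ) (ℕP.+-identityʳ j))
                             (solve 1 (λ c → con 1ℚ :* c :* con 1ℚ := c) refl (binom n j))

    sumTo-shift : ∀ n (G : ℕ → ℚ) → G (suc n) ≡ 0ℚ → sumTo n (λ k → G (suc k)) ≡ sumTo n G - G 0
    sumTo-shift n G G[1+n]≡0 = begin
      S                          ≡⟨ solve 2 (λ a b → a := (b :+ a) :- b) refl S (G 0) ⟩
      (G 0 + S) - G 0            ≡⟨ cong (_- G 0) (sym (sumBelow-head (suc n) G)) ⟩
      (sumTo n G + G (suc n)) - G 0 ≡⟨ cong (λ t → (sumTo n G + t) - G 0) G[1+n]≡0 ⟩
      (sumTo n G + 0ℚ) - G 0     ≡⟨ cong (_- G 0) (ℚP.+-identityʳ (sumTo n G)) ⟩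
      sumTo n G - G 0            ∎
      where S = sumTo n (λ k → G (suc k))

    summands-shift : ∀ n j → sumTo n (λ k → summand n j (suc k)) ≡ narayanaColumn j n - binom n j
    summands-shift n j = trans (sumTo-shift n (summand n j) beyond) (cong (λ c → narayanaColumn j n - c) (summand-head n j))
      where
      beyond : summand n j (suc n) ≡ 0ℚ
      beyond = trans (cong (λ c → c * binom n (j ℕ.+ suc n) * rpow (suc n)) (binom-vanish (ℕP.n<1+n n)))
                     (solve 2 (λ a b → con 0ℚ :* a :* b := con 0ℚ) refl (binom n (j ℕ.+ suc n)) (rpow (suc n)))

    crossSum : ℕ → ℕ → ℚ
    crossSum j n = sumTo n (λ k → binom n (suc k) * binom n (j ℕ.+ k) * rpow (suc k))

    -- Pascal's rule in both binomials of a summand.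
    summand-suc : ∀ n j k → summand (suc n) j (suc k) ≡
      ρ * summand n j k + ρ * summand n (suc j) k + binom n (suc k) * binom n (j ℕ.+ k) * rpow (suc k) + summand n j (suc k)
    summand-suc n j k = begin
      binom (suc n) (suc k) * binom (suc n) (j ℕ.+ suc k) * rpow (suc k)
        ≡⟨ cong (λ c → binom (suc n) (suc k) * c * rpow (suc k)) (binom-+-suc (suc n) j k) ⟩
      binom (suc n) (suc k) * binom (suc n) (suc (j ℕ.+ k)) * rpow (suc k)
        ≡⟨ cong₂ (λ x y → x * y * rpow (suc k)) (trans (cong ℕ→ℚ (pascal n k)) (ℕ→ℚ-+ (n C k) _))
                                                (trans (cong ℕ→ℚ (pascal n (j ℕ.+ k))) (ℕ→ℚ-+ (n C (j ℕ.+ k)) _)) ⟩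
      (a + b) * (c + d) * rpow (suc k)
        ≡⟨ cong (λ t → (a + b) * (c + d) * t) (rpow-suc k) ⟩
      (a + b) * (c + d) * (ρ * rpow k)
        ≡⟨ solve 6 (λ a b c d p rk → (a :+ b) :* (c :+ d) :* (p :* rk)
                                   := p :* (a :* c :* rk) :+ p :* (a :* d :* rk) :+ b :* c :* (p :* rk) :+ b :* d :* (p :* rk))
                   refl a b c d ρ (rpow k) ⟩
      ρ * (a * c * rpow k) + ρ * (a * d * rpow k) + b * c * (ρ * rpow k) + b * d * (ρ * rpow k)
        ≡⟨ cong₂ (λ s t → ρ * (a * c * rpow k) + ρ * (a * d * rpow k) + b * c * s + t)
                 (sym (rpow-suc k)) (cong₂ (λ x y → b * x * y) (sym (binom-+-suc n j k)) (sym (rpow-suc k))) ⟩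
      ρ * summand n j k + ρ * summand n (suc j) k + b * c * rpow (suc k) + summand n j (suc k) ∎
      where a = binom n k
            b = binom n (suc k)
            c = binom n (j ℕ.+ k)
            d = binom n (suc (j ℕ.+ k))

    narayanaColumn-suc : ∀ j n → narayanaColumn j (suc n) ≡
      binom (suc n) j + (ρ * narayanaColumn j n + ρ * narayanaColumn (suc j) n + crossSum j n + (narayanaColumn j n - binom n j))
    narayanaColumn-suc j n = begin
      narayanaColumn j (suc n)
        ≡⟨ sumBelow-head (suc n) (summand (suc n) j) ⟩
      summand (suc n) j 0 + sumTo n (λ k → summand (suc n) j (suc k))
        ≡⟨ cong (summand (suc n) j 0 +_) (sumBelow-ext (suc n) (summand-suc n j)) ⟩
      summand (suc n) j 0 + sumTo n (λ k → ρ * summand n j k + ρ * summand n (suc j) k + cross k + summand n j (suc k))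
        ≡⟨ cong₂ _+_ (summand-head (suc n) j) (trans (sumBelow-+ (suc n) _ _) (cong₂ _+_
             (trans (sumBelow-+ (suc n) _ _) (cong (_+ crossSum j n) (trans (sumBelow-+ (suc n) _ _)
               (cong₂ _+_ (sumBelow-*ˡ (suc n) ρ _) (sumBelow-*ˡ (suc n) ρ _)))))
             (summands-shift n j))) ⟩
      binom (suc n) j + (ρ * narayanaColumn j n + ρ * narayanaColumn (suc j) n + crossSum j n + (narayanaColumn j n - binom n j)) ∎
      where
      cross : ℕ → ℚ
      cross k = binom n (suc k) * binom n (j ℕ.+ k) * rpow (suc k)

    crossSum-suc : ∀ j n → crossSum (suc j) n ≡ narayanaColumn j n - binom n j
    crossSum-suc j n = trans (sumBelow-ext (suc n) (λ k → cong (λ c → binom n (suc k) * c * rpow (suc k)) (sym (binom-+-suc n j k))))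
                             (summands-shift n j)

    crossSum-zero : ∀ n → crossSum 0 n ≡ ρ * narayanaColumn 1 n
    crossSum-zero n = trans (sumBelow-ext (suc n) (λ k → trans (cong (binom n (suc k) * binom n k *_) (rpow-suc k))
                              (solve 4 (λ b a p x → b :* a :* (p :* x) := p :* (a :* b :* x)) refl (binom n (suc k)) (binom n k) ρ (rpow k))))
                            (sumBelow-*ˡ (suc n) ρ _)

  narayanaColumn-rec : ∀ j n → narayanaColumn (suc j) (suc n) ≡
    narayanaColumn j n + (1ℚ + ρ) * narayanaColumn (suc j) n + ρ * narayanaColumn (suc (suc j)) n
  narayanaColumn-rec j n = begin
    narayanaColumn (suc j) (suc n)
      ≡⟨ narayanaColumn-suc (suc j) n ⟩
    binom (suc n) (suc j) + (ρ * y + ρ * z + crossSum (suc j) n + (y - binom n (suc j)))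
      ≡⟨ cong₂ (λ s t → s + (ρ * y + ρ * z + t + (y - binom n (suc j))))
               (trans (cong ℕ→ℚ (pascal n j)) (ℕ→ℚ-+ (n C j) _)) (crossSum-suc j n) ⟩
    (binom n j + binom n (suc j)) + (ρ * y + ρ * z + (x - binom n j) + (y - binom n (suc j)))
      ≡⟨ solve 6 (λ a b p x y z → (a :+ b) :+ (p :* y :+ p :* z :+ (x :- a) :+ (y :- b)) := x :+ (con 1ℚ :+ p) :* y :+ p :* z)
                 refl (binom n j) (binom n (suc j)) ρ x y z ⟩
    x + (1ℚ + ρ) * y + ρ * z ∎
    where x = narayanaColumn j n
          y = narayanaColumn (suc j) n
          z = narayanaColumn (suc (suc j)) n

  narayanaColumn-rec₀ : ∀ n → narayanaColumn 0 (suc n) ≡ (1ℚ + ρ) * narayanaColumn 0 n + (ρ + ρ) * narayanaColumn 1 n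
  narayanaColumn-rec₀ n = begin
    narayanaColumn 0 (suc n)                                      ≡⟨ narayanaColumn-suc 0 n ⟩
    1ℚ + (ρ * x + ρ * y + crossSum 0 n + (x - 1ℚ))                ≡⟨ cong (λ t → 1ℚ + (ρ * x + ρ * y + t + (x - 1ℚ))) (crossSum-zero n) ⟩
    1ℚ + (ρ * x + ρ * y + ρ * y + (x - 1ℚ))                       ≡⟨ solve 3 (λ p x y → con 1ℚ :+ (p :* x :+ p :* y :+ p :* y :+ (x :- con 1ℚ))
                                                                                   := (con 1ℚ :+ p) :* x :+ (p :+ p) :* y) refl ρ x y ⟩
    (1ℚ + ρ) * x + (ρ + ρ) * y                                    ∎
    where x = narayanaColumn 0 n
          y = narayanaColumn 1 n

  narayanaPoly-columns : ∀ n → narayanaPoly r n ≡ narayanaColumn 0 n - ρ * narayanaColumn 2 n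
  narayanaPoly-columns n = begin
    narayanaPoly r n                                          ≡⟨ sumBelow-head n _ ⟩
    1ℚ * 1ℚ + sumBelow n (λ k → narayana n (suc k) * rpow (suc k))
      ≡⟨ cong (1ℚ * 1ℚ +_) (trans (sumBelow-ext n term) (trans (sumBelow-− n _ _) (cong (λ c → A - c) (sumBelow-*ˡ n ρ _)))) ⟩
    1ℚ * 1ℚ + (A - ρ * B)                                     ≡⟨ solve 3 (λ a b p → con 1ℚ :* con 1ℚ :+ (a :- p :* b)
                                                                              := (con 1ℚ :* con 1ℚ :* con 1ℚ :+ a) :- p :* (b :+ con 0ℚ)) refl A B ρ ⟩
    (1ℚ * 1ℚ * 1ℚ + A) - ρ * (B + 0ℚ)                         ≡⟨ cong₂ (λ s t → s - ρ * (B + t)) (sym (sumBelow-head n (summand n 0))) last-vanishes ⟩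
    narayanaColumn 0 n - ρ * narayanaColumn 2 n               ∎
    where
    A = sumBelow n (λ k → summand n 0 (suc k))
    B = sumBelow n (summand n 2)
    last-vanishes : 0ℚ ≡ summand n 2 n
    last-vanishes = sym (trans (cong (λ c → binom n n * c * rpow n) (binom-vanish (ℕP.m<n+m n {2} (s≤s z≤n))))
                               (solve 2 (λ a b → a :* con 0ℚ :* b := con 0ℚ) refl (binom n n) (rpow n)))
    term : ∀ k → narayana n (suc k) * rpow (suc k) ≡ summand n 0 (suc k) - ρ * summand n 2 k
    term k = begin
      narayana n (suc k) * rpow (suc k)           ≡⟨ cong₂ _*_ (narayana-suc n k) (rpow-suc k) ⟩
      (x * x - y * z) * (ρ * rpow k)
        ≡⟨ solve 5 (λ x y z p t → (x :* x :- y :* z) :* (p :* t) := x :* x :* (p :* t) :- p :* (z :* y :* t))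
                 refl x y z ρ (rpow k) ⟩
      x * x * (ρ * rpow k) - ρ * (z * y * rpow k) ≡⟨ cong (λ t → x * x * t - ρ * (z * y * rpow k)) (sym (rpow-suc k)) ⟩
      summand n 0 (suc k) - ρ * summand n 2 k     ∎
      where x = binom n (suc k)
            y = binom n (suc (suc k))
            z = binom n k

module Integrality where
  open Casts
  open PowerSeries
  open InverseAndSquareRoot using (invPS-suc)
  open import Data.Nat.Induction using (<-rec)
  open import Data.Integer as ℤ using (ℤ; +_)
  open Q using (_+_)

  IsInteger : ℚ → Set
  IsInteger q = Σ ℤ (λ z → q ≡ ℤ→ℚ z)

  isInteger-+ : ∀ {p q} → IsInteger p → IsInteger q → IsInteger (p + q)
  isInteger-+ (a , refl) (b , refl) = a ℤ.+ b , sym (ℤ→ℚ-+ a b)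

  isInteger-* : ∀ {p q} → IsInteger p → IsInteger q → IsInteger (p * q)
  isInteger-* (a , refl) (b , refl) = a ℤ.* b , sym (ℤ→ℚ-* a b)

  isInteger-neg : ∀ {p} → IsInteger p → IsInteger (- p)
  isInteger-neg (a , refl) = ℤ.- a , sym (ℤ→ℚ-neg a)

  isInteger-− : ∀ {p q} → IsInteger p → IsInteger q → IsInteger (p - q)
  isInteger-− a b = isInteger-+ a (isInteger-neg b)

  isInteger-ℕ : ∀ n → IsInteger (ℕ→ℚ n)
  isInteger-ℕ n = + n , refl

  IntegerSeries : PS → Set
  IntegerSeries a = ∀ n → IsInteger (a n)

  isInteger-cong : ∀ {p q} → p ≡ q → IsInteger p → IsInteger q
  isInteger-cong refl p-int = p-int

  isInteger-sumBelow : ∀ n {f : ℕ → ℚ} → (∀ i → i < n → IsInteger (f i)) → IsInteger (sumBelow n f)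
  isInteger-sumBelow zero    f-int = + 0 , refl
  isInteger-sumBelow (suc n) f-int =
    isInteger-+ (isInteger-sumBelow n (λ i i<n → f-int i (ℕP.m<n⇒m<1+n i<n))) (f-int n ℕP.≤-refl)

  integerSeries-⊛ : ∀ {a b} → IntegerSeries a → IntegerSeries b → IntegerSeries (a ⊛ b)
  integerSeries-⊛ a-int b-int n = isInteger-sumBelow (suc n) (λ i _ → isInteger-* (a-int i) (b-int (n ∸ i)))

  integerSeries-constPS : ∀ {c} → IsInteger c → IntegerSeries (constPS c)
  integerSeries-constPS c-int zero    = c-int
  integerSeries-constPS c-int (suc n) = + 0 , refl

  integerSeries-X : IntegerSeries X
  integerSeries-X 0             = + 0 , refl
  integerSeries-X 1             = + 1 , refl
  integerSeries-X (suc (suc n)) = + 0 , refl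

  integerSeries-poly4 : ∀ {c₀ c₁ c₂ c₃ c₄} → IsInteger c₀ → IsInteger c₁ → IsInteger c₂ → IsInteger c₃ → IsInteger c₄ →
                        IntegerSeries (poly4 c₀ c₁ c₂ c₃ c₄)
  integerSeries-poly4 i₀ i₁ i₂ i₃ i₄ 0 = i₀
  integerSeries-poly4 i₀ i₁ i₂ i₃ i₄ 1 = i₁
  integerSeries-poly4 i₀ i₁ i₂ i₃ i₄ 2 = i₂
  integerSeries-poly4 i₀ i₁ i₂ i₃ i₄ 3 = i₃
  integerSeries-poly4 i₀ i₁ i₂ i₃ i₄ 4 = i₄
  integerSeries-poly4 i₀ i₁ i₂ i₃ i₄ (suc (suc (suc (suc (suc _))))) = + 0 , refl

  integerSeries-invPS : ∀ a → IntegerSeries a → IntegerSeries (invPS a)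
  integerSeries-invPS a a-int = <-rec _ integral
    where
    integral : ∀ n → (∀ {i} → i < n → IsInteger (invPS a i)) → IsInteger (invPS a n)
    integral zero    _  = + 1 , refl
    integral (suc m) ih = isInteger-cong (sym (invPS-suc a m))
      (isInteger-neg (isInteger-sumBelow (suc m) (λ j _ → isInteger-* (a-int (suc j)) (ih (s≤s (ℕP.m∸n≤m m j))))))

module SeriesG (r : ℕ) where
  open PowerSeries
  open PowerSeriesSolver using (solve; _:+_; _:*_; :-_; _:=_; con)
  open InverseAndSquareRoot
  open Composition
  open Parameter r
  open Q using (_+_)
  open ≈-Reasoning

  numerator discriminant oneMinusX² : PS
  numerator    = poly4 1ℚ (- (ρ - 1ℚ)) 1ℚ 0ℚ 0ℚ
  discriminant = poly4 1ℚ (- (ℕ→ℚ 2 * (ρ - 1ℚ))) (ρ * ρ - ℕ→ℚ 6 * ρ + ℕ→ℚ 3) (- (ℕ→ℚ 2 * (ρ - 1ℚ))) 1ℚ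
  oneMinusX²   = poly4 1ℚ 0ℚ (- 1ℚ) 0ℚ 0ℚ

  F : PS
  F = constPS ½ ⊛ (numerator ⊕ sqrtPS discriminant)

  numeratorAt oneMinusSquareAt : PS → PS
  numeratorAt y      = (oneS ⊕ negPS ((R ⊕ negPS oneS) ⊛ y)) ⊕ (y ⊛ y)
  oneMinusSquareAt y = oneS ⊕ negPS (y ⊛ y)

  numerator-quartic : ∀ y → quartic (constPS 1ℚ) (constPS (- (ρ - 1ℚ))) (constPS 1ℚ) (constPS 0ℚ) (constPS 0ℚ) y ≈ numeratorAt y
  numerator-quartic y = begin
    quartic (constPS 1ℚ) (constPS (- (ρ - 1ℚ))) (constPS 1ℚ) (constPS 0ℚ) (constPS 0ℚ) y
      ≈⟨ quartic-cong y (≈-refl {oneS}) (≈-trans (constPS-neg _) (negPS-cong (constPS-− ρ 1ℚ)))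
                        (≈-refl {oneS}) (≈-refl {constPS 0ℚ}) (≈-refl {constPS 0ℚ}) ⟩
    quartic oneS (negPS (R ⊕ negPS oneS)) oneS (constPS 0ℚ) (constPS 0ℚ) y
      ≈⟨ solve 2 (λ ρ y → con 1ℚ :+ y :* (:- (ρ :+ :- con 1ℚ) :+ y :* (con 1ℚ :+ y :* (con 0ℚ :+ y :* con 0ℚ)))
                       := (con 1ℚ :+ :- ((ρ :+ :- con 1ℚ) :* y)) :+ y :* y) (λ _ → refl) R y ⟩
    numeratorAt y ∎

  oneMinusX²-quartic : ∀ y → quartic (constPS 1ℚ) (constPS 0ℚ) (constPS (- 1ℚ)) (constPS 0ℚ) (constPS 0ℚ) y ≈ oneMinusSquareAt y
  oneMinusX²-quartic y = solve 1 (λ y → con 1ℚ :+ y :* (con 0ℚ :+ y :* (con (- 1ℚ) :+ y :* (con 0ℚ :+ y :* con 0ℚ)))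
                                     := con 1ℚ :+ :- (y :* y)) (λ _ → refl) y

  discriminant-ring : discriminant ≈ ((numeratorAt X ⊛ numeratorAt X) ⊕ negPS (constPS (ℕ→ℚ 4) ⊛ (R ⊛ (X ⊛ X))))
  discriminant-ring = begin
    discriminant
      ≈⟨ poly4-at-X _ _ _ _ _ ⟩
    quartic oneS (constPS c₁) (constPS c₂) (constPS c₁) oneS X
      ≈⟨ quartic-cong X (≈-refl {oneS}) c₁-ring c₂-ring c₁-ring (≈-refl {oneS}) ⟩
    quartic oneS (negPS (constPS (ℕ→ℚ 2) ⊛ (R ⊕ negPS oneS))) (((R ⊛ R) ⊕ negPS (constPS (ℕ→ℚ 6) ⊛ R)) ⊕ constPS (ℕ→ℚ 3))
            (negPS (constPS (ℕ→ℚ 2) ⊛ (R ⊕ negPS oneS))) oneS X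
      ≈⟨ solve 2 (λ ρ x → con 1ℚ :+ x :* (:- (con (ℕ→ℚ 2) :* (ρ :+ :- con 1ℚ)) :+ x :* (((ρ :* ρ :+ :- (con (ℕ→ℚ 6) :* ρ)) :+ con (ℕ→ℚ 3))
                             :+ x :* (:- (con (ℕ→ℚ 2) :* (ρ :+ :- con 1ℚ)) :+ x :* con 1ℚ)))
                       := ((con 1ℚ :+ :- ((ρ :+ :- con 1ℚ) :* x)) :+ x :* x) :* ((con 1ℚ :+ :- ((ρ :+ :- con 1ℚ) :* x)) :+ x :* x)
                          :+ :- (con (ℕ→ℚ 4) :* (ρ :* (x :* x)))) (λ _ → refl) R X ⟩
    (numeratorAt X ⊛ numeratorAt X) ⊕ negPS (constPS (ℕ→ℚ 4) ⊛ (R ⊛ (X ⊛ X))) ∎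
    where
    c₁ = - (ℕ→ℚ 2 * (ρ - 1ℚ))
    c₂ = ρ * ρ - ℕ→ℚ 6 * ρ + ℕ→ℚ 3
    c₁-ring : constPS c₁ ≈ negPS (constPS (ℕ→ℚ 2) ⊛ (R ⊕ negPS oneS))
    c₁-ring = ≈-trans (constPS-neg _) (negPS-cong (≈-trans (constPS-* _ _) (⊛-congˡ (constPS (ℕ→ℚ 2)) (constPS-− ρ 1ℚ))))
    c₂-ring : constPS c₂ ≈ (((R ⊛ R) ⊕ negPS (constPS (ℕ→ℚ 6) ⊛ R)) ⊕ constPS (ℕ→ℚ 3))
    c₂-ring = ≈-trans (constPS-+ _ _) (⊕-congʳ (constPS (ℕ→ℚ 3))
                (≈-trans (constPS-− _ _) (⊕-cong (constPS-* ρ ρ) (negPS-cong (constPS-* (ℕ→ℚ 6) ρ)))))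

  F-quadratic : ((F ⊛ F) ⊕ (R ⊛ (X ⊛ X))) ≈ (numerator ⊛ F)
  F-quadratic = begin
    (F ⊛ F) ⊕ (R ⊛ (X ⊛ X))
      ≈⟨ solve 4 (λ n s ρ x → (con ½ :* (n :+ s)) :* (con ½ :* (n :+ s)) :+ ρ :* (x :* x)
                           := n :* (con ½ :* (n :+ s)) :+ con (½ * ½) :* (s :* s :+ :- (n :* n :+ :- (con (ℕ→ℚ 4) :* (ρ :* (x :* x))))))
                 (λ _ → refl) N S R X ⟩
    (N ⊛ F) ⊕ (¼ ⊛ ((S ⊛ S) ⊕ negPS ((N ⊛ N) ⊕ negPS E)))
      ≈⟨ ⊕-congˡ (N ⊛ F) (⊛-congˡ ¼ (⊕-cong (≈-trans (sqrtPS-square discriminant refl) discriminant-ring)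
                                           (negPS-cong (⊕-congʳ (negPS E) (⊛-cong N-ring N-ring))))) ⟩
    (N ⊛ F) ⊕ (¼ ⊛ (((N′ ⊛ N′) ⊕ negPS E) ⊕ negPS ((N′ ⊛ N′) ⊕ negPS E)))
      ≈⟨ solve 4 (λ m q n e → m :+ q :* ((n :* n :+ :- e) :+ :- (n :* n :+ :- e)) := m) (λ _ → refl) (N ⊛ F) ¼ N′ E ⟩
    N ⊛ F ∎
    where
    N  = numerator
    N′ = numeratorAt X
    S  = sqrtPS discriminant
    E  = constPS (ℕ→ℚ 4) ⊛ (R ⊛ (X ⊛ X))
    ¼  = constPS (½ * ½)
    N-ring : N ≈ N′
    N-ring = ≈-trans (poly4-at-X _ _ _ _ _) (numerator-quartic X)

  gSeries-quotient : gSeries r ≈ (invPS oneMinusX² ⊛ F)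
  gSeries-quotient = ≈-trans (λ n → sym (constPS-⊛ ½ (invPS oneMinusX² ⊛ (numerator ⊕ sqrtPS discriminant)) n))
    (solve 3 (λ i n s → con ½ :* (i :* (n :+ s)) := i :* (con ½ :* (n :+ s))) (λ _ → refl) (invPS oneMinusX²) numerator (sqrtPS discriminant))

  oneMinusX²-gSeries : (oneMinusX² ⊛ gSeries r) ≈ F
  oneMinusX²-gSeries = begin
    oneMinusX² ⊛ gSeries r                   ≈⟨ ⊛-congˡ oneMinusX² gSeries-quotient ⟩
    oneMinusX² ⊛ (invPS oneMinusX² ⊛ F)      ≈⟨ ⊛-assoc oneMinusX² (invPS oneMinusX²) F ⟨
    (oneMinusX² ⊛ invPS oneMinusX²) ⊛ F      ≈⟨ ⊛-congʳ F (invPS-inverseʳ oneMinusX² refl) ⟩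
    oneS ⊛ F                                 ≈⟨ ⊛-identityˡ F ⟩
    F                                        ∎

  gSeries-head : gSeries r 0 ≡ 1ℚ
  gSeries-head = refl

module SeriesGIntegral (r : ℕ) where
  open Casts
  open Sums
  open PowerSeries
  open InverseAndSquareRoot
  open Integrality
  open Parameter r
  open SeriesG r
  open Q using (_+_)
  open import Data.Nat.Induction using (<-rec)
  open import Data.Rational.Solver using (module +-*-Solver)
  open +-*-Solver using (solve; _:+_; _:*_; _:-_; _:=_; con)

  private
    Z : PS
    Z = R ⊛ (X ⊛ X)

  -- Comparing coefficients of x^(m+1) in F-quadratic, using F(0) = numerator(0) = 1.
  F-suc : ∀ m → F (suc m) ≡
    (sumBelow (suc m) (λ i → numerator (suc i) * F (m ∸ i)) - sumBelow m (λ j → F (suc j) * F (m ∸ j))) - Z (suc m)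
  F-suc m = begin
    a
      ≡⟨ solve 4 (λ a M T z → a := ((T :- M) :- z) :+ ((con 1ℚ :* a :+ (M :+ a :* con 1ℚ) :+ z) :- (con 1ℚ :* a :+ T)))
               refl a M T z ⟩
    ((T - M) - z) + ((1ℚ * a + (M + a * 1ℚ) + z) - (1ℚ * a + T)) ≡⟨ cong (λ t → ((T - M) - z) + (t - (1ℚ * a + T))) coefficient ⟩
    ((T - M) - z) + ((1ℚ * a + T) - (1ℚ * a + T))                 ≡⟨ cong (((T - M) - z) +_) (ℚP.+-inverseʳ (1ℚ * a + T)) ⟩
    ((T - M) - z) + 0ℚ                                            ≡⟨ ℚP.+-identityʳ _ ⟩
    (T - M) - z                                                   ∎
    where
    open ≡-Reasoning
    a = F (suc m)
    M = sumBelow m (λ j → F (suc j) * F (m ∸ j))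
    T = sumBelow (suc m) (λ i → numerator (suc i) * F (m ∸ i))
    z = Z (suc m)
    coefficient : (1ℚ * a + (M + a * 1ℚ)) + z ≡ 1ℚ * a + T
    coefficient = trans (cong (_+ z) (sym (square-suc F m))) (trans (F-quadratic (suc m)) (sumBelow-head (suc m) _))

  F-integer : IntegerSeries F
  F-integer = <-rec _ integral
    where
    numerator-integer : IntegerSeries numerator
    numerator-integer = integerSeries-poly4 (isInteger-ℕ 1) (isInteger-neg (isInteger-− (isInteger-ℕ r) (isInteger-ℕ 1)))
                                           (isInteger-ℕ 1) (isInteger-ℕ 0) (isInteger-ℕ 0)
    Z-integer : IntegerSeries Z
    Z-integer = integerSeries-⊛ (integerSeries-constPS (isInteger-ℕ r)) (integerSeries-⊛ integerSeries-X integerSeries-X)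
    integral : ∀ n → (∀ {i} → i < n → IsInteger (F i)) → IsInteger (F n)
    integral zero    _  = isInteger-ℕ 1
    integral (suc m) ih = isInteger-cong (sym (F-suc m))
      (isInteger-− (isInteger-− (isInteger-sumBelow (suc m) (λ i _ → isInteger-* (numerator-integer (suc i)) (ih (s≤s (ℕP.m∸n≤m m i)))))
                                (isInteger-sumBelow m (λ j j<m → isInteger-* (ih (s≤s j<m)) (ih (s≤s (ℕP.m∸n≤m m j))))))
                   (Z-integer (suc m)))

  gSeries-integer : IntegerSeries (gSeries r)
  gSeries-integer n = isInteger-cong (sym (gSeries-quotient n))
    (integerSeries-⊛ (integerSeries-invPS oneMinusX²
       (integerSeries-poly4 (isInteger-ℕ 1) (isInteger-ℕ 0) (isInteger-neg (isInteger-ℕ 1)) (isInteger-ℕ 0) (isInteger-ℕ 0))) F-integer n)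

module NarayanaEquation (r : ℕ) where
  open Casts
  open PowerSeries
  open InverseAndSquareRoot
  open Composition using (quartic; quartic-cong; poly4-at-X)
  open Parameter r
  open Q using (_+_)
  open import Data.Nat.Induction using (<-rec)

  linearFactor : PS
  linearFactor = oneS ⊕ negPS ((R ⊕ oneS) ⊛ X)

  SolvesNarayanaEquation : PS → Set
  SolvesNarayanaEquation y = (((R ⊛ (X ⊛ X)) ⊛ (y ⊛ y)) ⊕ oneS) ≈ (linearFactor ⊛ y)

  private
    recursive : PS → PS
    recursive y = ((R ⊕ oneS) ⊛ y) ⊕ (R ⊛ (X ⊛ (y ⊛ y)))

    solution-recursive : ∀ y → SolvesNarayanaEquation y → y ≈ (oneS ⊕ (X ⊛ recursive y))
    solution-recursive y eq = begin
      y
        ≈⟨ solve 3 (λ y x ρ → y := ((con 1ℚ :+ :- ((ρ :+ con 1ℚ) :* x)) :* y) :+ (ρ :+ con 1ℚ) :* (x :* y))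
                 (λ _ → refl) y X R ⟩
      (linearFactor ⊛ y) ⊕ ((R ⊕ oneS) ⊛ (X ⊛ y))                 ≈⟨ ⊕-congʳ ((R ⊕ oneS) ⊛ (X ⊛ y)) eq ⟨
      (((R ⊛ (X ⊛ X)) ⊛ (y ⊛ y)) ⊕ oneS) ⊕ ((R ⊕ oneS) ⊛ (X ⊛ y)) ≈⟨ solve 3 (λ y x ρ → ((ρ :* (x :* x)) :* (y :* y) :+ con 1ℚ) :+ (ρ :+ con 1ℚ) :* (x :* y)
                                                                                 := con 1ℚ :+ x :* ((ρ :+ con 1ℚ) :* y :+ ρ :* (x :* (y :* y))))
                                                                              (λ _ → refl) y X R ⟩
      oneS ⊕ (X ⊛ recursive y)                                    ∎
      where
      open ≈-Reasoning
      open PowerSeriesSolver using (solve; _:+_; _:*_; :-_; _:=_; con)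

  -- The equation determines coefficient n+1 from coefficients 0, …, n.
  narayanaEquation-unique : ∀ y₁ y₂ → SolvesNarayanaEquation y₁ → SolvesNarayanaEquation y₂ → y₁ ≈ y₂
  narayanaEquation-unique y₁ y₂ eq₁ eq₂ = <-rec _ agree
    where
    open ≡-Reasoning
    agree : ∀ n → (∀ {i} → i < n → y₁ i ≡ y₂ i) → y₁ n ≡ y₂ n
    agree zero    _  = begin
      y₁ 0                            ≡⟨ solution-recursive y₁ eq₁ 0 ⟩
      1ℚ + (X ⊛ recursive y₁) 0       ≡⟨ cong (1ℚ +_) (trans (X⊛-head (recursive y₁)) (sym (X⊛-head (recursive y₂)))) ⟩
      1ℚ + (X ⊛ recursive y₂) 0       ≡⟨ solution-recursive y₂ eq₂ 0 ⟨
      y₂ 0                            ∎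
    agree (suc n) ih = begin
      y₁ (suc n)                      ≡⟨ solution-recursive y₁ eq₁ (suc n) ⟩
      0ℚ + (X ⊛ recursive y₁) (suc n) ≡⟨ cong (0ℚ +_) (trans (X⊛-suc (recursive y₁) n) (trans same (sym (X⊛-suc (recursive y₂) n)))) ⟩
      0ℚ + (X ⊛ recursive y₂) (suc n) ≡⟨ solution-recursive y₂ eq₂ (suc n) ⟨
      y₂ (suc n)                      ∎
      where
      ≤n : ∀ i → i ≤ n → y₁ i ≡ y₂ i
      ≤n i i≤n = ih (s≤s i≤n)
      ≤≤n : ∀ i → i ≤ n → ∀ j → j ≤ i → y₁ j ≡ y₂ j
      ≤≤n i i≤n j j≤i = ≤n j (ℕP.≤-trans j≤i i≤n)
      same : recursive y₁ n ≡ recursive y₂ n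
      same = cong₂ _+_ (⊛-cong-≤ n (R ⊕ oneS) (R ⊕ oneS) y₁ y₂ (λ _ _ → refl) ≤n)
                       (⊛-cong-≤ n R R (X ⊛ (y₁ ⊛ y₁)) (X ⊛ (y₂ ⊛ y₂)) (λ _ _ → refl) (λ i i≤n →
                         ⊛-cong-≤ i X X (y₁ ⊛ y₁) (y₂ ⊛ y₂) (λ _ _ → refl) (λ j j≤i →
                           ⊛-cong-≤ j y₁ y₂ y₁ y₂ (≤≤n j (ℕP.≤-trans j≤i i≤n)) (≤≤n j (ℕP.≤-trans j≤i i≤n)))))

  module _ (y : PS) (eq : SolvesNarayanaEquation y) where
    private
      M P : PS
      M = X ⊛ (X ⊛ (constPS (ℕ→ℚ 2) ⊛ (R ⊛ y)))
      P = linearFactor ⊕ negPS M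

      closedLinear closedDiscriminant : PS
      closedLinear       = poly4 1ℚ (- (ρ + 1ℚ)) 0ℚ 0ℚ 0ℚ
      closedDiscriminant = poly4 1ℚ (- (ℕ→ℚ 2 * (ρ + 1ℚ))) ((ρ - 1ℚ) * (ρ - 1ℚ)) 0ℚ 0ℚ

      R+1 : constPS (ρ + 1ℚ) ≈ (R ⊕ oneS)
      R+1 = constPS-+ ρ 1ℚ

      closedLinear-ring : closedLinear ≈ linearFactor
      closedLinear-ring = begin
        closedLinear
          ≈⟨ poly4-at-X _ _ _ _ _ ⟩
        quartic oneS (constPS (- (ρ + 1ℚ))) (constPS 0ℚ) (constPS 0ℚ) (constPS 0ℚ) X
          ≈⟨ quartic-cong X (≈-refl {oneS}) (≈-trans (constPS-neg _) (negPS-cong R+1))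
                            (≈-refl {constPS 0ℚ}) (≈-refl {constPS 0ℚ}) (≈-refl {constPS 0ℚ}) ⟩
        quartic oneS (negPS (R ⊕ oneS)) (constPS 0ℚ) (constPS 0ℚ) (constPS 0ℚ) X
          ≈⟨ solve 2 (λ ρ x → con 1ℚ :+ x :* (:- (ρ :+ con 1ℚ) :+ x :* (con 0ℚ :+ x :* (con 0ℚ :+ x :* con 0ℚ)))
                           := con 1ℚ :+ :- ((ρ :+ con 1ℚ) :* x)) (λ _ → refl) R X ⟩
        linearFactor ∎
        where
        open ≈-Reasoning
        open PowerSeriesSolver using (solve; _:+_; _:*_; :-_; _:=_; con)

      E : PS
      E = constPS (ℕ→ℚ 4) ⊛ (R ⊛ (X ⊛ X))

      closedDiscriminant-ring : closedDiscriminant ≈ ((linearFactor ⊛ linearFactor) ⊕ negPS E)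
      closedDiscriminant-ring = begin
        closedDiscriminant
          ≈⟨ poly4-at-X _ _ _ _ _ ⟩
        quartic oneS (constPS (- (ℕ→ℚ 2 * (ρ + 1ℚ)))) (constPS ((ρ - 1ℚ) * (ρ - 1ℚ))) (constPS 0ℚ) (constPS 0ℚ) X
          ≈⟨ quartic-cong X (≈-refl {oneS})
               (≈-trans (constPS-neg _) (negPS-cong (≈-trans (constPS-* _ _) (⊛-congˡ (constPS (ℕ→ℚ 2)) R+1))))
               (≈-trans (constPS-* _ _) (⊛-cong (constPS-− ρ 1ℚ) (constPS-− ρ 1ℚ))) (≈-refl {constPS 0ℚ}) (≈-refl {constPS 0ℚ}) ⟩
        quartic oneS (negPS (constPS (ℕ→ℚ 2) ⊛ (R ⊕ oneS))) ((R ⊕ negPS oneS) ⊛ (R ⊕ negPS oneS)) (constPS 0ℚ) (constPS 0ℚ) X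
          ≈⟨ solve 2 (λ ρ x → con 1ℚ :+ x :* (:- (con (ℕ→ℚ 2) :* (ρ :+ con 1ℚ)) :+ x :* ((ρ :+ :- con 1ℚ) :* (ρ :+ :- con 1ℚ)
                                :+ x :* (con 0ℚ :+ x :* con 0ℚ)))
                           := (con 1ℚ :+ :- ((ρ :+ con 1ℚ) :* x)) :* (con 1ℚ :+ :- ((ρ :+ con 1ℚ) :* x)) :+ :- (con (ℕ→ℚ 4) :* (ρ :* (x :* x))))
                     (λ _ → refl) R X ⟩
        (linearFactor ⊛ linearFactor) ⊕ negPS E ∎
        where
        open ≈-Reasoning
        open PowerSeriesSolver using (solve; _:+_; _:*_; :-_; _:=_; con)

      P-square : (P ⊛ P) ≈ closedDiscriminant
      P-square = begin
        P ⊛ P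
          ≈⟨ solve 5 (λ l ρ x y z → (l :+ :- (x :* (x :* (con (ℕ→ℚ 2) :* (ρ :* y))))) :* (l :+ :- (x :* (x :* (con (ℕ→ℚ 2) :* (ρ :* y)))))
                                 := ((l :* l) :+ :- (con (ℕ→ℚ 4) :* (ρ :* (x :* x))))
                                    :+ (con (ℕ→ℚ 4) :* (ρ :* (x :* x))) :* ((((ρ :* (x :* x)) :* (y :* y)) :+ con 1ℚ) :+ :- (l :* y)))
                     (λ _ → refl) linearFactor R X y zeroPS ⟩
        ((linearFactor ⊛ linearFactor) ⊕ negPS E) ⊕ (F₄ ⊛ ((((R ⊛ (X ⊛ X)) ⊛ (y ⊛ y)) ⊕ oneS) ⊕ negPS (linearFactor ⊛ y)))
          ≈⟨ ⊕-congˡ ((linearFactor ⊛ linearFactor) ⊕ negPS E) (⊛-congˡ F₄ (⊕-congʳ (negPS (linearFactor ⊛ y)) eq)) ⟩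
        ((linearFactor ⊛ linearFactor) ⊕ negPS E) ⊕ (F₄ ⊛ ((linearFactor ⊛ y) ⊕ negPS (linearFactor ⊛ y)))
          ≈⟨ solve 3 (λ d f t → d :+ f :* (t :+ :- t) := d) (λ _ → refl) ((linearFactor ⊛ linearFactor) ⊕ negPS E) F₄ (linearFactor ⊛ y) ⟩
        (linearFactor ⊛ linearFactor) ⊕ negPS E
          ≈⟨ closedDiscriminant-ring ⟨
        closedDiscriminant ∎
        where
        open ≈-Reasoning
        open PowerSeriesSolver using (solve; _:+_; _:*_; :-_; _:=_; con)
        F₄ = constPS (ℕ→ℚ 4) ⊛ (R ⊛ (X ⊛ X))

      P-head : P 0 ≡ 1ℚ
      P-head = cong₂ (λ a b → (1ℚ + - a) + - b) (trans (⊛-head (R ⊕ oneS) X) (ℚP.*-zeroʳ (ρ + 1ℚ)))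
                                                (X⊛-head (X ⊛ (constPS (ℕ→ℚ 2) ⊛ (R ⊛ y))))

    closedNumer-solution : closedNumer r ≈ (X ⊛ (X ⊛ (constPS (ℕ→ℚ 2) ⊛ (R ⊛ y))))
    closedNumer-solution n = begin
      closedLinear n - sqrtPS closedDiscriminant n ≡⟨ cong₂ _-_ (closedLinear-ring n) (sym (sqrtPS-unique closedDiscriminant P P-head P-square n)) ⟩
      linearFactor n - (linearFactor n + - M n)    ≡⟨ solve 2 (λ l m → l :- (l :+ :- m) := m) refl (linearFactor n) (M n) ⟩
      M n                                          ∎
      where
      open ≡-Reasoning
      open import Data.Rational.Solver using (module +-*-Solver)
      open +-*-Solver using (solve; _:+_; :-_; _:-_; _:=_)

    closedNumer-coefficients : closedNumer r 0 ≡ 0ℚ × closedNumer r 1 ≡ 0ℚ ×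
                               (∀ n → ℕ→ℚ (2 ℕ.* r) * y n ≡ closedNumer r (n ℕ.+ 2))
    closedNumer-coefficients =
      trans (closedNumer-solution 0) (X⊛-head M₁) ,
      trans (closedNumer-solution 1) (trans (X⊛-suc M₁ 0) (X⊛-head M₂)) ,
      λ n → sym (begin
        closedNumer r (n ℕ.+ 2)         ≡⟨ cong (closedNumer r) (ℕP.+-comm n 2) ⟩
        closedNumer r (suc (suc n))     ≡⟨ closedNumer-solution (suc (suc n)) ⟩
        (X ⊛ M₁) (suc (suc n))          ≡⟨ trans (X⊛-suc M₁ (suc n)) (X⊛-suc M₂ n) ⟩
        (constPS (ℕ→ℚ 2) ⊛ (R ⊛ y)) n   ≡⟨ trans (constPS-⊛ (ℕ→ℚ 2) (R ⊛ y) n) (cong (ℕ→ℚ 2 *_) (constPS-⊛ ρ y n)) ⟩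
        ℕ→ℚ 2 * (ρ * y n)               ≡⟨ sym (ℚP.*-assoc (ℕ→ℚ 2) ρ (y n)) ⟩
        ℕ→ℚ 2 * ρ * y n                 ≡⟨ cong (_* y n) (sym (ℕ→ℚ-* 2 r)) ⟩
        ℕ→ℚ (2 ℕ.* r) * y n             ∎)
      where
      open ≡-Reasoning
      M₂ = constPS (ℕ→ℚ 2) ⊛ (R ⊛ y)
      M₁ = X ⊛ M₂

module NarayanaSeries (r : ℕ) where
  open Q using (_+_)
  open PowerSeries
  open PowerSeriesSolver using (solve; _:+_; _:*_; :-_; _:=_; con)
  open Parameter r
  open NarayanaColumns r
  open NarayanaEquation r
  open RiordanColumns (1ℚ + ρ) ρ renaming (kernelRoot to w; kernelRoot-equation to w-equation)
  open ≈-Reasoning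

  private
    A : ℕ → PS
    A = narayanaColumn

    columns : ∀ j → A j ≈ (powPS w j ⊛ A 0)
    columns j n = riordan-columns narayanaColumn (λ _ → refl) narayanaColumn-rec j n

    1+R : constPS (1ℚ + ρ) ≈ (oneS ⊕ R)
    1+R = constPS-+ 1ℚ ρ

    A₀-equation : A 0 ≈ (oneS ⊕ (X ⊛ ((constPS (1ℚ + ρ) ⊛ A 0) ⊕ (constPS (ρ + ρ) ⊛ A 1))))
    A₀-equation = head+X⊛tail (A 0) _ (λ n → trans (narayanaColumn-rec₀ n)
      (sym (cong₂ _+_ (constPS-⊛ (1ℚ + ρ) (A 0) n) (constPS-⊛ (ρ + ρ) (A 1) n))))

    A₁-column : A 1 ≈ (w ⊛ A 0)
    A₁-column = ≈-trans (columns 1) (⊛-congʳ (A 0) (⊛-identityʳ w))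

    A₂-column : A 2 ≈ (w ⊛ (w ⊛ A 0))
    A₂-column = ≈-trans (columns 2) (solve 2 (λ w a → (w :* (w :* con 1ℚ)) :* a := w :* (w :* a)) (λ _ → refl) w (A 0))

    kernel′ : PS
    kernel′ = (oneS ⊕ ((oneS ⊕ R) ⊛ w)) ⊕ (R ⊛ (w ⊛ w))

    w-equation′ : w ≈ (X ⊛ kernel′)
    w-equation′ = ≈-trans w-equation (⊛-congˡ X (⊕-congʳ (R ⊛ (w ⊛ w)) (⊕-congˡ oneS (⊛-congʳ w 1+R))))

    K : PS
    K = oneS ⊕ negPS (X ⊛ ((oneS ⊕ R) ⊕ ((R ⊕ R) ⊛ w)))

    A₀-inverse : (A 0 ⊛ K) ≈ oneS
    A₀-inverse = begin
      A 0 ⊛ K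
        ≈⟨ solve 4 (λ a x w ρ → a :* (con 1ℚ :+ :- (x :* ((con 1ℚ :+ ρ) :+ (ρ :+ ρ) :* w)))
                             := a :+ :- (x :* ((con 1ℚ :+ ρ) :* a :+ (ρ :+ ρ) :* (w :* a)))) (λ _ → refl) (A 0) X w R ⟩
      A 0 ⊕ negPS (X ⊛ (((oneS ⊕ R) ⊛ A 0) ⊕ ((R ⊕ R) ⊛ (w ⊛ A 0))))
        ≈⟨ ⊕-cong A₀-equation (negPS-cong (⊛-congˡ X (⊕-cong (⊛-congʳ (A 0) (≈-sym 1+R))
                                                            (⊛-cong (≈-sym (constPS-+ ρ ρ)) (≈-sym A₁-column))))) ⟩
      (oneS ⊕ (X ⊛ T)) ⊕ negPS (X ⊛ T)
        ≈⟨ solve 1 (λ t → (con 1ℚ :+ t) :+ :- t := con 1ℚ) (λ _ → refl) (X ⊛ T) ⟩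
      oneS ∎
      where T = (constPS (1ℚ + ρ) ⊛ A 0) ⊕ (constPS (ρ + ρ) ⊛ A 1)

    w-K : (w ⊛ K) ≈ (X ⊛ (oneS ⊕ negPS (R ⊛ (w ⊛ w))))
    w-K = begin
      w ⊛ K
        ≈⟨ solve 3 (λ w x ρ → w :* (con 1ℚ :+ :- (x :* ((con 1ℚ :+ ρ) :+ (ρ :+ ρ) :* w)))
                           := w :+ :- (x :* ((con 1ℚ :+ ρ) :* w :+ (ρ :+ ρ) :* (w :* w)))) (λ _ → refl) w X R ⟩
      w ⊕ negPS (X ⊛ (((oneS ⊕ R) ⊛ w) ⊕ ((R ⊕ R) ⊛ (w ⊛ w))))
        ≈⟨ ⊕-congʳ (negPS (X ⊛ (((oneS ⊕ R) ⊛ w) ⊕ ((R ⊕ R) ⊛ (w ⊛ w))))) w-equation′ ⟩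
      (X ⊛ kernel′) ⊕ negPS (X ⊛ (((oneS ⊕ R) ⊛ w) ⊕ ((R ⊕ R) ⊛ (w ⊛ w))))
        ≈⟨ solve 3 (λ w x ρ → x :* ((con 1ℚ :+ (con 1ℚ :+ ρ) :* w) :+ ρ :* (w :* w)) :+ :- (x :* ((con 1ℚ :+ ρ) :* w :+ (ρ :+ ρ) :* (w :* w)))
                           := x :* (con 1ℚ :+ :- (ρ :* (w :* w)))) (λ _ → refl) w X R ⟩
      X ⊛ (oneS ⊕ negPS (R ⊛ (w ⊛ w))) ∎

  X⊛narayana : (X ⊛ narayanaPoly r) ≈ w
  X⊛narayana = begin
    X ⊛ narayanaPoly r
      ≈⟨ ⊛-congˡ X (λ n → trans (narayanaPoly-columns n) (cong (λ c → A 0 n - c) (sym (constPS-⊛ ρ (A 2) n)))) ⟩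
    X ⊛ (A 0 ⊕ negPS (R ⊛ A 2))
      ≈⟨ ⊛-congˡ X (⊕-congˡ (A 0) (negPS-cong (⊛-congˡ R A₂-column))) ⟩
    X ⊛ (A 0 ⊕ negPS (R ⊛ (w ⊛ (w ⊛ A 0))))
      ≈⟨ solve 4 (λ x a ρ w → x :* (a :+ :- (ρ :* (w :* (w :* a)))) := (x :* (con 1ℚ :+ :- (ρ :* (w :* w)))) :* a) (λ _ → refl) X (A 0) R w ⟩
    (X ⊛ (oneS ⊕ negPS (R ⊛ (w ⊛ w)))) ⊛ A 0
      ≈⟨ ⊛-congʳ (A 0) w-K ⟨
    (w ⊛ K) ⊛ A 0
      ≈⟨ solve 3 (λ w k a → (w :* k) :* a := w :* (a :* k)) (λ _ → refl) w K (A 0) ⟩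
    w ⊛ (A 0 ⊛ K)
      ≈⟨ ⊛-congˡ w A₀-inverse ⟩
    w ⊛ oneS
      ≈⟨ ⊛-identityʳ w ⟩
    w ∎

  narayana-solves : SolvesNarayanaEquation (narayanaPoly r)
  narayana-solves = X⊛-injective _ _ (begin
    X ⊛ (((R ⊛ (X ⊛ X)) ⊛ (N ⊛ N)) ⊕ oneS)
      ≈⟨ solve 3 (λ x ρ n → x :* ((ρ :* (x :* x)) :* (n :* n) :+ con 1ℚ) := ρ :* (x :* ((x :* n) :* (x :* n))) :+ x) (λ _ → refl) X R N ⟩
    (R ⊛ (X ⊛ ((X ⊛ N) ⊛ (X ⊛ N)))) ⊕ X
      ≈⟨ ⊕-congʳ X (⊛-congˡ R (⊛-congˡ X (⊛-cong X⊛narayana X⊛narayana))) ⟩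
    (R ⊛ (X ⊛ (w ⊛ w))) ⊕ X
      ≈⟨ solve 3 (λ x ρ w → ρ :* (x :* (w :* w)) :+ x
                         := x :* ((con 1ℚ :+ (con 1ℚ :+ ρ) :* w) :+ ρ :* (w :* w)) :+ :- ((ρ :+ con 1ℚ) :* (x :* w))) (λ _ → refl) X R w ⟩
    (X ⊛ kernel′) ⊕ negPS ((R ⊕ oneS) ⊛ (X ⊛ w))
      ≈⟨ ⊕-congʳ (negPS ((R ⊕ oneS) ⊛ (X ⊛ w))) w-equation′ ⟨
    w ⊕ negPS ((R ⊕ oneS) ⊛ (X ⊛ w))
      ≈⟨ solve 3 (λ x ρ w → w :+ :- ((ρ :+ con 1ℚ) :* (x :* w)) := (con 1ℚ :+ :- ((ρ :+ con 1ℚ) :* x)) :* w) (λ _ → refl) X R w ⟩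
    linearFactor ⊛ w
      ≈⟨ ⊛-congˡ linearFactor X⊛narayana ⟨
    linearFactor ⊛ (X ⊛ N)
      ≈⟨ solve 3 (λ l x n → l :* (x :* n) := x :* (l :* n)) (λ _ → refl) linearFactor X N ⟩
    X ⊛ (linearFactor ⊛ N) ∎)
    where N = narayanaPoly r

module CentralTransform where
  open Sums
  open Binomials using (binom; pascal)
  open Casts using (ℕ→ℚ-+)
  open import Data.Nat.Combinatorics using (_C_)
  open PowerSeries
  open PowerSeriesSolver using (solve; _:+_; _:*_; :-_; _:=_; con)
  open Composition
  open CentralColumns
  open RiordanColumns (ℕ→ℚ 2) 1ℚ public using () renaming (kernelRoot to v; kernelRoot-equation to v-equation)
  open RiordanColumns (ℕ→ℚ 2) 1ℚ using (riordan-columns)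
  open Q using (_+_)

  private
    binomialColumn : ℕ → PS
    binomialColumn m = geomPS ⊛ powPS xOver1mx m

    xOver1mx-equation : xOver1mx ≈ (X ⊛ (oneS ⊕ xOver1mx))
    xOver1mx-equation = ≈-trans (head+X⊛tail xOver1mx (oneS ⊕ xOver1mx) tail)
                                (solve 1 (λ t → con 0ℚ :+ t := t) (λ _ → refl) (X ⊛ (oneS ⊕ xOver1mx)))
      where
      tail : ∀ n → xOver1mx (suc n) ≡ (oneS ⊕ xOver1mx) n
      tail zero    = refl
      tail (suc n) = refl

    binomialColumn-suc : ∀ m → binomialColumn (suc m) ≈ ((X ⊛ binomialColumn m) ⊕ (X ⊛ binomialColumn (suc m)))
    binomialColumn-suc m = ≈-trans (⊛-congˡ geomPS (⊛-congʳ (powPS xOver1mx m) xOver1mx-equation))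
      (solve 4 (λ g x o p → g :* ((x :* (con 1ℚ :+ o)) :* p) := x :* (g :* p) :+ x :* (g :* (o :* p)))
             (λ _ → refl) geomPS X xOver1mx (powPS xOver1mx m))

  binomialColumn-coeff : ∀ N m → (geomPS ⊛ powPS xOver1mx m) N ≡ binom N m
  binomialColumn-coeff zero    zero    = refl
  binomialColumn-coeff zero    (suc m) = trans (binomialColumn-suc m 0)
    (cong₂ _+_ (X⊛-head (binomialColumn m)) (X⊛-head (binomialColumn (suc m))))
  binomialColumn-coeff (suc N) zero    = ⊛-identityʳ geomPS (suc N)
  binomialColumn-coeff (suc N) (suc m) = begin
    binomialColumn (suc m) (suc N)                                  ≡⟨ binomialColumn-suc m (suc N) ⟩
    (X ⊛ binomialColumn m) (suc N) + (X ⊛ binomialColumn (suc m)) (suc N)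
                                                                    ≡⟨ cong₂ _+_ (X⊛-suc (binomialColumn m) N) (X⊛-suc (binomialColumn (suc m)) N) ⟩
    binomialColumn m N + binomialColumn (suc m) N                    ≡⟨ cong₂ _+_ (binomialColumn-coeff N m) (binomialColumn-coeff N (suc m)) ⟩
    binom N m + binom N (suc m)                                     ≡⟨ sym (ℕ→ℚ-+ (N C m) (N C suc m)) ⟩
    ℕ→ℚ (N C m ℕ.+ N C suc m)                                       ≡⟨ cong ℕ→ℚ (sym (pascal N m)) ⟩
    binom (suc N) (suc m)                                           ∎
    where open ≡-Reasoning

  tArr-binomial : ∀ g → g 0 ≡ 1ℚ → ∀ N k → tArr g N k ≡ sumTo N (λ i → invPS g i * binom N (i ℕ.+ k))
  tArr-binomial g g₀≡1 N k = begin
    (geomPS ⊛ (invPS (compose g xOver1mx) ⊛ powPS xOver1mx k)) N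
      ≡⟨ ⊛-congˡ geomPS (⊛-congʳ (powPS xOver1mx k) (≈-sym (compose-invPS g xOver1mx g₀≡1 refl))) N ⟩
    (geomPS ⊛ (compose h xOver1mx ⊛ powPS xOver1mx k)) N
      ≡⟨ solve 3 (λ g c p → g :* (c :* p) := c :* (g :* p)) (λ _ → refl) geomPS (compose h xOver1mx) (powPS xOver1mx k) N ⟩
    (compose h xOver1mx ⊛ (geomPS ⊛ powPS xOver1mx k)) N
      ≡⟨ compose-⊛-coeff h xOver1mx refl (geomPS ⊛ powPS xOver1mx k) N ⟩
    sumTo N (λ i → h i * (powPS xOver1mx i ⊛ (geomPS ⊛ powPS xOver1mx k)) N)
      ≡⟨ sumBelow-ext (suc N) (λ i → cong (h i *_) (trans (shift-power i N) (binomialColumn-coeff N (i ℕ.+ k)))) ⟩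
    sumTo N (λ i → h i * binom N (i ℕ.+ k)) ∎
    where
    open ≡-Reasoning
    h = invPS g
    shift-power : ∀ i → (powPS xOver1mx i ⊛ (geomPS ⊛ powPS xOver1mx k)) ≈ (geomPS ⊛ powPS xOver1mx (i ℕ.+ k))
    shift-power i = ≈-trans (solve 3 (λ a g b → a :* (g :* b) := g :* (a :* b)) (λ _ → refl) (powPS xOver1mx i) geomPS (powPS xOver1mx k))
                            (⊛-congˡ geomPS (≈-sym (powPS-+ xOver1mx i k)))

  centralTransform-columns : ∀ g → g 0 ≡ 1ℚ → ∀ n → centralTransform g n ≡ sumTo n (λ i → invPS g i * centralColumn i n)
  centralTransform-columns g g₀≡1 n = trans (tArr-binomial g g₀≡1 (n ℕ.+ n) n)
    (sumBelow-truncate (s≤s (ℕP.m≤m+n n n)) (λ i n<i _ → trans (cong (invPS g i *_) (centralColumn-vanish i n n<i)) (ℚP.*-zeroʳ (invPS g i))))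

  centralTransform-compose : ∀ g → g 0 ≡ 1ℚ → centralTransform g ≈ (compose (invPS g) v ⊛ centralColumn 0)
  centralTransform-compose g g₀≡1 n = begin
    centralTransform g n                                          ≡⟨ centralTransform-columns g g₀≡1 n ⟩
    sumTo n (λ i → invPS g i * centralColumn i n)                 ≡⟨ sumBelow-ext (suc n) (λ i → cong (invPS g i *_) (columns i n)) ⟩
    sumTo n (λ i → invPS g i * (powPS v i ⊛ centralColumn 0) n)   ≡⟨ compose-⊛-coeff (invPS g) v refl (centralColumn 0) n ⟨
    (compose (invPS g) v ⊛ centralColumn 0) n                     ∎
    where
    open ≡-Reasoning
    columns = riordan-columns centralColumn (λ _ → refl) centralColumn-rec

  centralColumn₀-inverse : (centralColumn 0 ⊛ (oneS ⊕ negPS (X ⊛ (constPS (ℕ→ℚ 2) ⊛ (oneS ⊕ v))))) ≈ oneS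
  centralColumn₀-inverse = begin
    A₀ ⊛ (oneS ⊕ negPS (X ⊛ (constPS (ℕ→ℚ 2) ⊛ (oneS ⊕ v))))
      ≈⟨ solve 3 (λ a x v → a :* (con 1ℚ :+ :- (x :* (con (ℕ→ℚ 2) :* (con 1ℚ :+ v))))
                         := a :+ :- (x :* (con (ℕ→ℚ 2) :* a :+ con (ℕ→ℚ 2) :* (v :* a)))) (λ _ → refl) A₀ X v ⟩
    A₀ ⊕ negPS (X ⊛ ((constPS (ℕ→ℚ 2) ⊛ A₀) ⊕ (constPS (ℕ→ℚ 2) ⊛ (v ⊛ A₀))))
      ≈⟨ ⊕-cong A₀-equation
           (negPS-cong (⊛-congˡ X (⊕-congˡ (constPS (ℕ→ℚ 2) ⊛ A₀) (⊛-congˡ (constPS (ℕ→ℚ 2)) (≈-sym A₁-column))))) ⟩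
    (oneS ⊕ (X ⊛ T)) ⊕ negPS (X ⊛ T)
      ≈⟨ solve 1 (λ t → (con 1ℚ :+ t) :+ :- t := con 1ℚ) (λ _ → refl) (X ⊛ T) ⟩
    oneS ∎
    where
    open ≈-Reasoning
    A₀ = centralColumn 0
    T = (constPS (ℕ→ℚ 2) ⊛ A₀) ⊕ (constPS (ℕ→ℚ 2) ⊛ centralColumn 1)
    A₀-equation : A₀ ≈ (oneS ⊕ (X ⊛ T))
    A₀-equation = head+X⊛tail A₀ T (λ n → trans (centralColumn-rec₀ n)
      (sym (cong₂ _+_ (constPS-⊛ (ℕ→ℚ 2) A₀ n) (constPS-⊛ (ℕ→ℚ 2) (centralColumn 1) n))))
    A₁-column : centralColumn 1 ≈ (v ⊛ A₀)
    A₁-column n = trans (riordan-columns centralColumn (λ _ → refl) centralColumn-rec 1 n) (⊛-congʳ A₀ (⊛-identityʳ v) n)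

module CentralTransformOfG (r : ℕ) where
  open PowerSeries
  open PowerSeriesSolver using (solve; _:+_; _:*_; :-_; _:=_; con)
  open InverseAndSquareRoot
  open Composition
  open Parameter r
  open SeriesG r
  open NarayanaEquation r
  open CentralColumns using (centralColumn)
  open CentralTransform
  open Q using (_+_)
  open ≈-Reasoning

  private
    B Y K Gv Fv Z : PS
    B  = centralTransform (gSeries r)
    Y  = oneS ⊕ v
    K  = oneS ⊕ negPS (X ⊛ (constPS (ℕ→ℚ 2) ⊛ Y))
    Gv = compose (gSeries r) v
    Fv = compose F v
    Z  = Gv ⊛ (K ⊛ (Y ⊛ Y))

    X⊛Y² : (X ⊛ (Y ⊛ Y)) ≈ v
    X⊛Y² = ≈-sym (≈-trans v-equation
      (solve 2 (λ x v → x :* ((con 1ℚ :+ con (ℕ→ℚ 2) :* v) :+ con 1ℚ :* (v :* v)) := x :* ((con 1ℚ :+ v) :* (con 1ℚ :+ v))) (λ _ → refl) X v))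

    oneMinusX²-at-v : (oneMinusSquareAt v ⊛ Gv) ≈ Fv
    oneMinusX²-at-v = begin
      oneMinusSquareAt v ⊛ Gv              ≈⟨ ⊛-congʳ Gv (≈-trans (compose-poly4 _ _ _ _ _ v refl) (oneMinusX²-quartic v)) ⟨
      compose oneMinusX² v ⊛ Gv            ≈⟨ compose-⊛ oneMinusX² (gSeries r) v refl ⟨
      compose (oneMinusX² ⊛ gSeries r) v   ≈⟨ compose-cong v oneMinusX²-gSeries ⟩
      Fv                                   ∎

    Z≈Fv : Z ≈ Fv
    Z≈Fv = begin
      Gv ⊛ (K ⊛ (Y ⊛ Y))
        ≈⟨ solve 3 (λ g x v → g :* ((con 1ℚ :+ :- (x :* (con (ℕ→ℚ 2) :* (con 1ℚ :+ v)))) :* ((con 1ℚ :+ v) :* (con 1ℚ :+ v)))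
                           := g :* ((con 1ℚ :+ v) :* (con 1ℚ :+ v) :+ :- (con (ℕ→ℚ 2) :* ((x :* ((con 1ℚ :+ v) :* (con 1ℚ :+ v))) :* (con 1ℚ :+ v)))))
                   (λ _ → refl) Gv X v ⟩
      Gv ⊛ ((Y ⊛ Y) ⊕ negPS (constPS (ℕ→ℚ 2) ⊛ ((X ⊛ (Y ⊛ Y)) ⊛ Y)))
        ≈⟨ ⊛-congˡ Gv (⊕-congˡ (Y ⊛ Y) (negPS-cong (⊛-congˡ (constPS (ℕ→ℚ 2)) (⊛-congʳ Y X⊛Y²)))) ⟩
      Gv ⊛ ((Y ⊛ Y) ⊕ negPS (constPS (ℕ→ℚ 2) ⊛ (v ⊛ Y)))
        ≈⟨ solve 2 (λ g v → g :* ((con 1ℚ :+ v) :* (con 1ℚ :+ v) :+ :- (con (ℕ→ℚ 2) :* (v :* (con 1ℚ :+ v)))) := (con 1ℚ :+ :- (v :* v)) :* g)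
                   (λ _ → refl) Gv v ⟩
      oneMinusSquareAt v ⊛ Gv
        ≈⟨ oneMinusX²-at-v ⟩
      Fv ∎

    B⊛Z : (B ⊛ Z) ≈ (Y ⊛ Y)
    B⊛Z = begin
      B ⊛ Z
        ≈⟨ ⊛-congʳ Z (centralTransform-compose (gSeries r) refl) ⟩
      (Hv ⊛ centralColumn 0) ⊛ (Gv ⊛ (K ⊛ (Y ⊛ Y)))
        ≈⟨ solve 5 (λ h a g k y → (h :* a) :* (g :* (k :* y)) := (h :* g) :* ((a :* k) :* y)) (λ _ → refl) Hv (centralColumn 0) Gv K (Y ⊛ Y) ⟩
      (Hv ⊛ Gv) ⊛ ((centralColumn 0 ⊛ K) ⊛ (Y ⊛ Y))
        ≈⟨ ⊛-cong Hv⊛Gv (⊛-congʳ (Y ⊛ Y) centralColumn₀-inverse) ⟩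
      oneS ⊛ (oneS ⊛ (Y ⊛ Y))
        ≈⟨ solve 1 (λ y → con 1ℚ :* (con 1ℚ :* y) := y) (λ _ → refl) (Y ⊛ Y) ⟩
      Y ⊛ Y ∎
      where
      Hv = compose (invPS (gSeries r)) v
      Hv⊛Gv : (Hv ⊛ Gv) ≈ oneS
      Hv⊛Gv = ≈-trans (⊛-congʳ Gv (compose-invPS (gSeries r) v refl refl)) (invPS-inverseˡ Gv refl)

    F-quadratic-at-v : ((Fv ⊛ Fv) ⊕ (R ⊛ (v ⊛ v))) ≈ (numeratorAt v ⊛ Fv)
    F-quadratic-at-v = begin
      (Fv ⊛ Fv) ⊕ (R ⊛ (v ⊛ v))
        ≈⟨ ⊕-cong (compose-⊛ F F v refl) (≈-trans (compose-⊛ R (X ⊛ X) v refl)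
                    (⊛-cong (compose-constPS ρ v) (≈-trans (compose-⊛ X X v refl) (⊛-cong (compose-X v refl) (compose-X v refl))))) ⟨
      compose (F ⊛ F) v ⊕ compose (R ⊛ (X ⊛ X)) v
        ≈⟨ compose-⊕ (F ⊛ F) (R ⊛ (X ⊛ X)) v ⟨
      compose ((F ⊛ F) ⊕ (R ⊛ (X ⊛ X))) v
        ≈⟨ compose-cong v F-quadratic ⟩
      compose (numerator ⊛ F) v
        ≈⟨ compose-⊛ numerator F v refl ⟩
      compose numerator v ⊛ Fv
        ≈⟨ ⊛-congʳ Fv (≈-trans (compose-poly4 _ _ _ _ _ v refl) (numerator-quartic v)) ⟩
      numeratorAt v ⊛ Fv ∎

  -- Multiply the equation by Z² and use B Z = (1 + v)², Z = F(v), x (1 + v)² = v.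
  centralTransform-solves : SolvesNarayanaEquation B
  centralTransform-solves = ⊛-cancelʳ _ _ (Z ⊛ Z) refl (begin
    (((R ⊛ (X ⊛ X)) ⊛ (B ⊛ B)) ⊕ oneS) ⊛ (Z ⊛ Z)
      ≈⟨ solve 4 (λ ρ x b z → ((ρ :* (x :* x)) :* (b :* b) :+ con 1ℚ) :* (z :* z) := ρ :* ((x :* (b :* z)) :* (x :* (b :* z))) :+ z :* z)
                 (λ _ → refl) R X B Z ⟩
    (R ⊛ ((X ⊛ (B ⊛ Z)) ⊛ (X ⊛ (B ⊛ Z)))) ⊕ (Z ⊛ Z)
      ≈⟨ ⊕-cong (⊛-congˡ R (⊛-cong X⊛BZ X⊛BZ)) (⊛-cong Z≈Fv Z≈Fv) ⟩
    (R ⊛ (v ⊛ v)) ⊕ (Fv ⊛ Fv)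
      ≈⟨ solve 3 (λ ρ v f → ρ :* (v :* v) :+ f :* f := f :* f :+ ρ :* (v :* v)) (λ _ → refl) R v Fv ⟩
    (Fv ⊛ Fv) ⊕ (R ⊛ (v ⊛ v))
      ≈⟨ F-quadratic-at-v ⟩
    numeratorAt v ⊛ Fv
      ≈⟨ solve 3 (λ ρ v f → ((con 1ℚ :+ :- ((ρ :+ :- con 1ℚ) :* v)) :+ v :* v) :* f
                         := ((con 1ℚ :+ v) :* (con 1ℚ :+ v) :+ :- ((ρ :+ con 1ℚ) :* v)) :* f) (λ _ → refl) R v Fv ⟩
    ((Y ⊛ Y) ⊕ negPS ((R ⊕ oneS) ⊛ v)) ⊛ Fv
      ≈⟨ ⊛-congʳ Fv (⊕-congˡ (Y ⊛ Y) (negPS-cong (⊛-congˡ (R ⊕ oneS) X⊛Y²))) ⟨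
    ((Y ⊛ Y) ⊕ negPS ((R ⊕ oneS) ⊛ (X ⊛ (Y ⊛ Y)))) ⊛ Fv
      ≈⟨ solve 4 (λ ρ x y f → (y :+ :- ((ρ :+ con 1ℚ) :* (x :* y))) :* f := (con 1ℚ :+ :- ((ρ :+ con 1ℚ) :* x)) :* y :* f)
                 (λ _ → refl) R X (Y ⊛ Y) Fv ⟩
    (linearFactor ⊛ (Y ⊛ Y)) ⊛ Fv
      ≈⟨ ⊛-cong (⊛-congˡ linearFactor B⊛Z) Z≈Fv ⟨
    (linearFactor ⊛ (B ⊛ Z)) ⊛ Z
      ≈⟨ solve 3 (λ l b z → (l :* (b :* z)) :* z := (l :* b) :* (z :* z)) (λ _ → refl) linearFactor B Z ⟩
    (linearFactor ⊛ B) ⊛ (Z ⊛ Z) ∎)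
    where
    X⊛BZ : (X ⊛ (B ⊛ Z)) ≈ v
    X⊛BZ = ≈-trans (⊛-congˡ X B⊛Z) X⊛Y²

open import Data.Nat using (_+_) renaming (_*_ to _*ℕ_)
open import Data.Integer using (ℤ)
open SeriesG using (gSeries-head)
open SeriesGIntegral using (gSeries-integer)
open NarayanaEquation using (narayanaEquation-unique; closedNumer-coefficients)
open NarayanaSeries using (narayana-solves)
open CentralTransformOfG using (centralTransform-solves)

mainTheorem9 : (r : ℕ) → 1 ≤ r →
    Σ (ℕ → ℤ) (λ G → (∀ n → gSeries r n ≡ ℤ→ℚ (G n)))
    × gSeries r 0 ≡ 1ℚ
    × (∀ n → centralTransform (gSeries r) n ≡ narayanaPoly r n)
    × closedNumer r 0 ≡ 0ℚ
    × closedNumer r 1 ≡ 0ℚ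
    × (∀ n → ℕ→ℚ (2 *ℕ r) * centralTransform (gSeries r) n ≡ closedNumer r (n + 2))
mainTheorem9 r _ =
  ((λ n → proj₁ (gSeries-integer r n)) , (λ n → proj₂ (gSeries-integer r n))) ,
  gSeries-head r ,
  central≈narayana ,
  closedNumer-coefficients r (centralTransform (gSeries r)) (centralTransform-solves r)
  where
  central≈narayana : ∀ n → centralTransform (gSeries r) n ≡ narayanaPoly r n
  central≈narayana = narayanaEquation-unique r _ _ (centralTransform-solves r) (narayana-solves r)
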